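{- Let $p\ge5$ be a prime and write $p-1=12m+4\delta+6\varepsilon$ with $m\in\mathbb{Z}_{\ge0}$ and $\delta,\varepsilon\in\{0,1\}$. Then the four polynomials $A_{m+\delta+\varepsilon,2}(X)$, $X^{\delta}A_{m+\varepsilon,6}(X)$, $(X-1728)^{\varepsilon}A_{m+\delta,8}(X)$ and $X^{\delta}(X-1728)^{\varepsilon}A_{m+1,0}(X)$ have $p$-integral coefficients and are pairwise congruent modulo $p$: \[ A_{m +\delta +\varepsilon,2}(X) \equiv X^{\delta} A_{m+\varepsilon,6}(X) \equiv (X -1728)^{\varepsilon} A_{m +\delta,8}(X) \equiv X^{\delta} (X -1728)^{\varepsilon} A_{m+1,0}(X) \pmod{p}. \]
   Context: Define rational functions $a_0(x)=\frac{24(144x^2-41)}{(2x+1)(2x-1)}$, $b_0(x)=\frac{36(12x-11)(12x-7)(12x-5)(12x-1)}{x(x-1)(2x-1)^2}$, $a_2(x)=\frac{24(144x^2-29)}{(2x+1)(2x-1)}$, $b_2(x)=\frac{36(12x-13)(12x-7)(12x-5)(12x+1)}{x(x-1)(2x-1)^2}$, and set $a_{n,0}=a_0(n)$, $b_{n,0}=b_0(n)$, $a_{n,2}=a_2(n)$, $b_{n,2}=b_2(n)$, $a_{n,6}=a_0(n+\tfrac12)$, $b_{n,6}=b_0(n+\tfrac12)$, $a_{n,8}=a_2(n+\tfrac12)$, $b_{n,8}=b_2(n+\tfrac12)$. The Atkin-like polynomials $A_{n,r}(X)\in\mathbb{Q}[X]$ ($r\in\{0,2,6,8\}$, $n\ge0$)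 are determined by $A_{n+1,r}=(X-a_{n,r})A_{n,r}-b_{n,r}A_{n-1,r}$, valid for $n\ge2$ when $r\in\{0,2\}$ and $n\ge1$ when $r\in\{6,8\}$, with initial values $A_{0,0}=0$, $A_{1,0}=1$, $A_{2,0}=X-824$; $A_{0,2}=1$, $A_{1,2}=X-720$, $A_{2,2}=X^2-1640X+269280$; $A_{0,6}=1$, $A_{1,6}=X-1266$; $A_{0,8}=1$, $A_{1,8}=X-330$. ($A_{n,2}$ is Atkin's orthogonal polynomial.) -}

module Defs where

open import Data.Nat as ℕ using (ℕ; zero; suc)
open import Data.Nat.Divisibility using (_∣_)
open import Data.Integer as ℤ using (ℤ; +_)
open import Data.Rational as ℚ using (ℚ; 0ℚ; 1ℚ; ½; _+_; _*_; _-_; -_; _÷_)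
open ℚ.ℚ using (numerator; denominatorℕ)
open import Data.Product using (_×_)
open import Data.Rational.Properties using (_≟_)
open import Data.List using (List; []; _∷_)
open import Relation.Nullary using (¬_; yes; no)

c : ℕ → ℚ
c n = (+ n) ℚ./ 1

-- Division on ℚ, made total by the convention x / 0 = 0.
-- It is only ever applied below at points where the denominator is nonzero.
_⊘_ : ℚ → ℚ → ℚ
x ⊘ y with y ≟ 0ℚ
... | yes _ = 0ℚ
... | no y≢0 = _÷_ x y {{ℚ.≢-nonZero y≢0}}

a₀ : ℚ → ℚ
a₀ x = (c 24 * (c 144 * x * x - c 41)) ⊘ ((c 2 * x + c 1) * (c 2 * x - c 1))

b₀ : ℚ → ℚ
b₀ x = (c 36 * (c 12 * x - c 11) * (c 12 * x - c 7) * (c 12 * x - c 5) * (c 12 * x - c 1))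
     ⊘ (x * (x - c 1) * (c 2 * x - c 1) * (c 2 * x - c 1))

a₂ : ℚ → ℚ
a₂ x = (c 24 * (c 144 * x * x - c 29)) ⊘ ((c 2 * x + c 1) * (c 2 * x - c 1))

b₂ : ℚ → ℚ
b₂ x = (c 36 * (c 12 * x - c 13) * (c 12 * x - c 7) * (c 12 * x - c 5) * (c 12 * x + c 1))
     ⊘ (x * (x - c 1) * (c 2 * x - c 1) * (c 2 * x - c 1))

a[_,0] a[_,2] a[_,6] a[_,8] b[_,0] b[_,2] b[_,6] b[_,8] : ℕ → ℚ
a[ n ,0] = a₀ (c n)
b[ n ,0] = b₀ (c n)
a[ n ,2] = a₂ (c n)
b[ n ,2] = b₂ (c n)
a[ n ,6] = a₀ (c n + ½)
b[ n ,6] = b₀ (c n + ½)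
a[ n ,8] = a₂ (c n + ½)
b[ n ,8] = b₂ (c n + ½)

-- Polynomials in ℚ[X] as coefficient lists, lowest degree first
-- (trailing zeros allowed; equality/congruence is coefficientwise).

Poly : Set
Poly = List ℚ

coeff : Poly → ℕ → ℚ
coeff []       _       = 0ℚ
coeff (a ∷ _)  zero    = a
coeff (_ ∷ as) (suc i) = coeff as i

infixl 6 _⊕_ _⊖_
infixl 7 _⊛_ _·_

_⊕_ : Poly → Poly → Poly
[]       ⊕ q        = q
(a ∷ p)  ⊕ []       = a ∷ p
(a ∷ p)  ⊕ (b ∷ q)  = (a + b) ∷ (p ⊕ q)

_·_ : ℚ → Poly → Poly
k · []      = []
k · (a ∷ p) = (k * a) ∷ (k · p)

_⊖_ : Poly → Poly → Poly
p ⊖ q = p ⊕ (- 1ℚ) · q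

_⊛_ : Poly → Poly → Poly
[]      ⊛ q = []
(a ∷ p) ⊛ q = (a · q) ⊕ (0ℚ ∷ (p ⊛ q))

C : ℚ → Poly
C k = k ∷ []

X : Poly
X = 0ℚ ∷ 1ℚ ∷ []

X- : ℚ → Poly
X- k = (- k) ∷ 1ℚ ∷ []

_^ₚ_ : Poly → ℕ → Poly
p ^ₚ zero  = C 1ℚ
p ^ₚ suc n = p ⊛ (p ^ₚ n)

A[_,0] : ℕ → Poly
A[ 0 ,0] = []
A[ 1 ,0] = C 1ℚ
A[ 2 ,0] = X- (c 824)
A[ suc (suc (suc n)) ,0] =
  (X- a[ suc (suc n) ,0] ⊛ A[ suc (suc n) ,0]) ⊖ (b[ suc (suc n) ,0] · A[ suc n ,0])

A[_,2] : ℕ → Poly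
A[ 0 ,2] = C 1ℚ
A[ 1 ,2] = X- (c 720)
A[ 2 ,2] = c 269280 ∷ (- c 1640) ∷ 1ℚ ∷ []
A[ suc (suc (suc n)) ,2] =
  (X- a[ suc (suc n) ,2] ⊛ A[ suc (suc n) ,2]) ⊖ (b[ suc (suc n) ,2] · A[ suc n ,2])

A[_,6] : ℕ → Poly
A[ 0 ,6] = C 1ℚ
A[ 1 ,6] = X- (c 1266)
A[ suc (suc n) ,6] =
  (X- a[ suc n ,6] ⊛ A[ suc n ,6]) ⊖ (b[ suc n ,6] · A[ n ,6])

A[_,8] : ℕ → Poly
A[ 0 ,8] = C 1ℚ
A[ 1 ,8] = X- (c 330)
A[ suc (suc n) ,8] =
  (X- a[ suc n ,8] ⊛ A[ suc n ,8]) ⊖ (b[ suc n ,8] · A[ n ,8])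

PIntegral : ℕ → ℚ → Set
PIntegral p x = ¬ (p ∣ denominatorℕ x)

InPZp : ℕ → ℚ → Set
InPZp p x = PIntegral p x × (p ∣ ℤ.∣ numerator x ∣)

PIntegralPoly : ℕ → Poly → Set
PIntegralPoly p P = ∀ i → PIntegral p (coeff P i)

_≡_[modₚ_] : Poly → Poly → ℕ → Set
P ≡ Q [modₚ p ] = ∀ i → InPZp p (coeff P i - coeff Q i)

module Submission where

-- The four families are linked by two-term relations with explicit rational coefficients,
-- such as A_{n,2} = A_{n,6} + γ₂₆(n) A_{n-1,6} and A_{n+1,2} = X A_{n,6} + κ₂₆(n) A_{n,2}.
-- Each relation follows by induction along the three-term recurrences once its coefficient
-- satisfies a few identities between rational functions of n, which are checked after
-- clearing denominators. Every such coefficient is ±6(12n+a)(12n+b)/(n(2n±1)); writing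
-- p - 1 = 12m + 4δ + 6ε, the coefficients of the relations needed at index about m have a
-- numerator factor equal to p, while all denominators met up to that index are prime to p.
-- So the recurrences keep the polynomials p-integral and the relations become congruences.

open import Data.Bool using (Bool; true; T; _∧_)
open import Data.Empty using (⊥-elim)
open import Data.Integer as ℤ using (ℤ; +_; 0ℤ; 1ℤ)
import Data.Integer.Divisibility.Signed as ℤ∣
import Data.Integer.Properties as ℤ
open import Data.Integer.Tactic.RingSolver using (solve; solve-∀)
open import Data.List using (List; []; _∷_)
open import Data.Nat as ℕ using (ℕ; zero; suc; _≤_; _<_; z≤n; s≤s)
import Data.Nat.Coprimality as Coprime
open import Data.Nat.Divisibility as ℕ∣ using (_∣_; divides)
open import Data.Nat.Primality using (Prime; euclidsLemma; prime⇒nonTrivial)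
import Data.Nat.Properties as ℕ
import Data.Nat.Tactic.RingSolver as ℕ-Solver
open import Data.Product using (_×_; _,_; proj₁; proj₂)
open import Data.Rational as ℚ using (ℚ; 0ℚ; 1ℚ; ½; ↥_; ↧_; ↧ₙ_)
open import Data.Rational.Literals using (fromℤ)
import Data.Rational.Properties as ℚ
import Data.Rational.Unnormalised as ℚᵘ
import Data.Rational.Unnormalised.Properties as ℚᵘ
open import Data.Sum using (_⊎_; inj₁; inj₂; [_,_]′)
open import Data.Unit using (tt)
open import Function using (_∘_)
open import Level using (0ℓ)
open import Relation.Binary.PropositionalEquality
open import Relation.Nullary using (¬_; yes; no; does)
open import Relation.Nullary.Decidable.Core using (dec⇒maybe)
open import Tactic.RingSolver.Core.AlmostCommutativeRing using (AlmostCommutativeRing; fromCommutativeRing)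
import Tactic.RingSolver as RingSolver

open import Defs

-- The arithmetic of ℚ is opened only inside this block: the statement of the theorem uses ℕ's.
module _ where
  open import Data.Rational using (_+_; _*_; _-_; -_; 1/_)

  ℚ-ring : AlmostCommutativeRing 0ℓ 0ℓ
  ℚ-ring = fromCommutativeRing ℚ.+-*-commutativeRing (λ x → dec⇒maybe (0ℚ ℚ.≟ x))

  fromℤ-homo-+ : ∀ i j → fromℤ (i ℤ.+ j) ≡ fromℤ i + fromℤ j
  fromℤ-homo-+ i j = ℚ.toℚᵘ-injective
    (ℚᵘ.≃-trans (ℚᵘ.*≡* cross) (ℚᵘ.≃-sym (ℚ.toℚᵘ-homo-+ (fromℤ i) (fromℤ j))))
    where
    cross : (i ℤ.+ j) ℤ.* 1ℤ ≡ (i ℤ.* 1ℤ ℤ.+ j ℤ.* 1ℤ) ℤ.* 1ℤ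
    cross = solve (i ∷ j ∷ [])

  fromℤ-homo-* : ∀ i j → fromℤ (i ℤ.* j) ≡ fromℤ i * fromℤ j
  fromℤ-homo-* i j = ℚ.toℚᵘ-injective
    (ℚᵘ.≃-trans (ℚᵘ.*≡* refl) (ℚᵘ.≃-sym (ℚ.toℚᵘ-homo-* (fromℤ i) (fromℤ j))))

  fromℤ-homo‿- : ∀ i → fromℤ (ℤ.- i) ≡ - fromℤ i
  fromℤ-homo‿- i = ℚ.toℚᵘ-injective
    (ℚᵘ.≃-trans (ℚᵘ.*≡* refl) (ℚᵘ.≃-sym (ℚ.toℚᵘ-homo‿- (fromℤ i))))

  fromℤ-≢0 : ∀ {i} → i ≢ 0ℤ → fromℤ i ≢ 0ℚ
  fromℤ-≢0 i≢0 = i≢0 ∘ cong ↥_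

  c≡fromℤ : ∀ n → c n ≡ fromℤ (+ n)
  c≡fromℤ n = ℚ.normalize-coprime (Coprime.sym (Coprime.1-coprimeTo n))

  *-cancelʳ : ∀ {x y d} → d ≢ 0ℚ → x * d ≡ y * d → x ≡ y
  *-cancelʳ {x} {y} {d} d≢0 xd≡yd = begin
    x             ≡⟨ divide x ⟨
    x * d * 1/ d  ≡⟨ cong (_* 1/ d) xd≡yd ⟩
    y * d * 1/ d  ≡⟨ divide y ⟩
    y             ∎
    where
    open ≡-Reasoning
    instance
      d-nonZero : ℚ.NonZero d
      d-nonZero = ℚ.≢-nonZero d≢0
    divide : ∀ z → z * d * 1/ d ≡ z
    divide z = trans (ℚ.*-assoc z d (1/ d)) (trans (cong (z *_) (ℚ.*-inverseʳ d)) (ℚ.*-identityʳ z))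

  i*j≢0 : ∀ {i j} → i ≢ 0ℤ → j ≢ 0ℤ → i ℤ.* j ≢ 0ℤ
  i*j≢0 {i} i≢0 j≢0 = [ i≢0 , j≢0 ]′ ∘ ℤ.i*j≡0⇒i≡0∨j≡0 i

  record IsRatio (x : ℚ) (n d : ℤ) : Set where
    constructor ratio
    field
      denominator≢0 : d ≢ 0ℤ
      x*d≡n         : x * fromℤ d ≡ fromℤ n
  open IsRatio

  ratio-fromℤ : ∀ i → IsRatio (fromℤ i) i 1ℤ
  ratio-fromℤ i = ratio (λ ()) (ℚ.*-identityʳ (fromℤ i))

  ratio-c : ∀ n → IsRatio (c n) (+ n) 1ℤ
  ratio-c n = subst (λ x → IsRatio x (+ n) 1ℤ) (sym (c≡fromℤ n)) (ratio-fromℤ (+ n))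

  ratio-½ : IsRatio ½ 1ℤ (+ 2)
  ratio-½ = ratio (λ ()) refl

  ratio-canonical : ∀ x → IsRatio x (↥ x) (↧ x)
  ratio-canonical x@record{} = ratio (λ ()) (ℚ.toℚᵘ-injective
    (ℚᵘ.≃-trans (ℚ.toℚᵘ-homo-* x (fromℤ (↧ x))) (ℚᵘ.*≡* (cross (↥ x) (↧ x)))))
    where
    cross : ∀ n d → n ℤ.* d ℤ.* 1ℤ ≡ n ℤ.* (d ℤ.* 1ℤ)
    cross = solve-∀

  ratio-scale : ∀ {x n d} → IsRatio x n d → ∀ e → x * fromℤ (d ℤ.* e) ≡ fromℤ (n ℤ.* e)
  ratio-scale {x} {n} {d} r e = begin
    x * fromℤ (d ℤ.* e)      ≡⟨ cong (x *_) (fromℤ-homo-* d e) ⟩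
    x * (fromℤ d * fromℤ e)  ≡⟨ ℚ.*-assoc x (fromℤ d) (fromℤ e) ⟨
    x * fromℤ d * fromℤ e    ≡⟨ cong (_* fromℤ e) (x*d≡n r) ⟩
    fromℤ n * fromℤ e        ≡⟨ fromℤ-homo-* n e ⟨
    fromℤ (n ℤ.* e)          ∎
    where open ≡-Reasoning

  ratio-proportional : ∀ {x n₁ d₁ n₂ d₂} → IsRatio x n₁ d₁ → IsRatio x n₂ d₂ → n₁ ℤ.* d₂ ≡ n₂ ℤ.* d₁
  ratio-proportional {x} {n₁} {d₁} {n₂} {d₂} r₁ r₂ = cong ↥_ (begin
    fromℤ (n₁ ℤ.* d₂)      ≡⟨ ratio-scale r₁ d₂ ⟨
    x * fromℤ (d₁ ℤ.* d₂)  ≡⟨ cong (λ d → x * fromℤ d) (ℤ.*-comm d₁ d₂) ⟩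
    x * fromℤ (d₂ ℤ.* d₁)  ≡⟨ ratio-scale r₂ d₁ ⟩
    fromℤ (n₂ ℤ.* d₁)      ∎)
    where open ≡-Reasoning

  ratio-neg : ∀ {x n d} → IsRatio x n d → IsRatio (- x) (ℤ.- n) d
  ratio-neg {x} {n} {d} (ratio d≢0 x*d≡n) = ratio d≢0 (begin
    - x * fromℤ d    ≡⟨ ℚ.neg-distribˡ-* x (fromℤ d) ⟨
    - (x * fromℤ d)  ≡⟨ cong -_ x*d≡n ⟩
    - fromℤ n        ≡⟨ fromℤ-homo‿- n ⟨
    fromℤ (ℤ.- n)    ∎)
    where open ≡-Reasoning

  module _ {x y n₁ d₁ n₂ d₂} (r₁ : IsRatio x n₁ d₁) (r₂ : IsRatio y n₂ d₂) where
    private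
      D₁ D₂ : ℚ
      D₁ = fromℤ d₁
      D₂ = fromℤ d₂
      open ≡-Reasoning

    ratio-+ : IsRatio (x + y) (n₁ ℤ.* d₂ ℤ.+ n₂ ℤ.* d₁) (d₁ ℤ.* d₂)
    ratio-+ = ratio (i*j≢0 (denominator≢0 r₁) (denominator≢0 r₂)) (begin
      (x + y) * fromℤ (d₁ ℤ.* d₂)            ≡⟨ cong ((x + y) *_) (fromℤ-homo-* d₁ d₂) ⟩
      (x + y) * (D₁ * D₂)                    ≡⟨ expand x y D₁ D₂ ⟩
      x * D₁ * D₂ + y * D₂ * D₁              ≡⟨ cong₂ (λ u v → u * D₂ + v * D₁) (x*d≡n r₁) (x*d≡n r₂) ⟩
      fromℤ n₁ * D₂ + fromℤ n₂ * D₁          ≡⟨ cong₂ _+_ (fromℤ-homo-* n₁ d₂) (fromℤ-homo-* n₂ d₁) ⟨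
      fromℤ (n₁ ℤ.* d₂) + fromℤ (n₂ ℤ.* d₁)  ≡⟨ fromℤ-homo-+ (n₁ ℤ.* d₂) (n₂ ℤ.* d₁) ⟨
      fromℤ (n₁ ℤ.* d₂ ℤ.+ n₂ ℤ.* d₁)        ∎)
      where
      expand : ∀ x y a b → (x + y) * (a * b) ≡ x * a * b + y * b * a
      expand = RingSolver.solve-∀ ℚ-ring

    ratio-* : IsRatio (x * y) (n₁ ℤ.* n₂) (d₁ ℤ.* d₂)
    ratio-* = ratio (i*j≢0 (denominator≢0 r₁) (denominator≢0 r₂)) (begin
      x * y * fromℤ (d₁ ℤ.* d₂)  ≡⟨ cong (x * y *_) (fromℤ-homo-* d₁ d₂) ⟩
      x * y * (D₁ * D₂)          ≡⟨ regroup x y D₁ D₂ ⟩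
      x * D₁ * (y * D₂)          ≡⟨ cong₂ _*_ (x*d≡n r₁) (x*d≡n r₂) ⟩
      fromℤ n₁ * fromℤ n₂        ≡⟨ fromℤ-homo-* n₁ n₂ ⟨
      fromℤ (n₁ ℤ.* n₂)          ∎)
      where
      regroup : ∀ x y a b → x * y * (a * b) ≡ x * a * (y * b)
      regroup = RingSolver.solve-∀ ℚ-ring

    -- The denominator of y is passed in a normalised form m, so that callers can supply the
    -- equation n₂ ≡ m by a ring solver.
    ratio-⊘ : ∀ {m} → m ≢ 0ℤ → n₂ ≡ m → IsRatio (x ⊘ y) (n₁ ℤ.* d₂) (d₁ ℤ.* n₂)
    ratio-⊘ n₂≢0 refl with y ℚ.≟ 0ℚ
    ... | yes refl = ⊥-elim (fromℤ-≢0 n₂≢0 (trans (sym (x*d≡n r₂)) (ℚ.*-zeroˡ D₂)))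
    ... | no y≢0 = ratio (i*j≢0 (denominator≢0 r₁) n₂≢0) (begin
      x * 1/ y * fromℤ (d₁ ℤ.* n₂)  ≡⟨ cong (x * 1/ y *_) (trans (fromℤ-homo-* d₁ n₂) (cong (D₁ *_) (sym (x*d≡n r₂)))) ⟩
      x * 1/ y * (D₁ * (y * D₂))    ≡⟨ regroup x (1/ y) D₁ y D₂ ⟩
      x * D₁ * D₂ * (y * 1/ y)      ≡⟨ cong₂ (λ u v → u * D₂ * v) (x*d≡n r₁) (ℚ.*-inverseʳ y) ⟩
      fromℤ n₁ * D₂ * 1ℚ            ≡⟨ ℚ.*-identityʳ _ ⟩
      fromℤ n₁ * D₂                 ≡⟨ fromℤ-homo-* n₁ d₂ ⟨
      fromℤ (n₁ ℤ.* d₂)             ∎)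
      where
      instance
        y-nonZero : ℚ.NonZero y
        y-nonZero = ℚ.≢-nonZero y≢0
      regroup : ∀ x u a y b → x * u * (a * (y * b)) ≡ x * a * b * (y * u)
      regroup = RingSolver.solve-∀ ℚ-ring

    ≡-by-ratios : n₁ ℤ.* d₂ ≡ n₂ ℤ.* d₁ → x ≡ y
    ≡-by-ratios cross = *-cancelʳ (fromℤ-≢0 (i*j≢0 (denominator≢0 r₁) (denominator≢0 r₂))) (begin
      x * fromℤ (d₁ ℤ.* d₂)  ≡⟨ ratio-scale r₁ d₂ ⟩
      fromℤ (n₁ ℤ.* d₂)      ≡⟨ cong fromℤ cross ⟩
      fromℤ (n₂ ℤ.* d₁)      ≡⟨ ratio-scale r₂ d₁ ⟨
      y * fromℤ (d₂ ℤ.* d₁)  ≡⟨ cong (λ d → y * fromℤ d) (ℤ.*-comm d₂ d₁) ⟩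
      y * fromℤ (d₁ ℤ.* d₂)  ∎)

  ratio-- : ∀ {x y n₁ d₁ n₂ d₂} → IsRatio x n₁ d₁ → IsRatio y n₂ d₂ →
            IsRatio (x - y) (n₁ ℤ.* d₂ ℤ.+ ℤ.- n₂ ℤ.* d₁) (d₁ ℤ.* d₂)
  ratio-- r₁ r₂ = ratio-+ r₁ (ratio-neg r₂)

  ratio-reexpress : ∀ {x n d n′ d′} → IsRatio x n d → d′ ≢ 0ℤ → n ℤ.* d′ ≡ n′ ℤ.* d → IsRatio x n′ d′
  ratio-reexpress {x} {n} {d} {n′} {d′} r d′≢0 cross = ratio d′≢0 (*-cancelʳ (fromℤ-≢0 (denominator≢0 r)) (begin
    x * fromℤ d′ * fromℤ d    ≡⟨ ℚ.*-assoc x _ _ ⟩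
    x * (fromℤ d′ * fromℤ d)  ≡⟨ cong (x *_) (fromℤ-homo-* d′ d) ⟨
    x * fromℤ (d′ ℤ.* d)      ≡⟨ cong (λ e → x * fromℤ e) (ℤ.*-comm d′ d) ⟩
    x * fromℤ (d ℤ.* d′)      ≡⟨ ratio-scale r d′ ⟩
    fromℤ (n ℤ.* d′)          ≡⟨ cong fromℤ cross ⟩
    fromℤ (n′ ℤ.* d)          ≡⟨ fromℤ-homo-* n′ d ⟩
    fromℤ n′ * fromℤ d        ∎))
    where open ≡-Reasoning

  module _ {x n d} (r : IsRatio x n d) where
    private
      ratio-affine+ : ∀ {y z α β} → IsRatio y α 1ℤ → IsRatio z β 1ℤ → IsRatio (y * x + z) (α ℤ.* n ℤ.+ β ℤ.* d) d
      ratio-affine+ {α = α} {β} rα rβ = ratio-reexpress (ratio-+ (ratio-* rα r) rβ) (denominator≢0 r) (solve (α ∷ β ∷ n ∷ d ∷ []))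

      ratio-affine- : ∀ {y z α β} → IsRatio y α 1ℤ → IsRatio z β 1ℤ → IsRatio (y * x - z) (α ℤ.* n ℤ.- β ℤ.* d) d
      ratio-affine- {α = α} {β} rα rβ = ratio-reexpress (ratio-- (ratio-* rα r) rβ) (denominator≢0 r) (solve (α ∷ β ∷ n ∷ d ∷ []))

      ratio-a-denominator : IsRatio ((c 2 * x + c 1) * (c 2 * x - c 1)) ((+ 2 ℤ.* n ℤ.+ + 1 ℤ.* d) ℤ.* (+ 2 ℤ.* n ℤ.- + 1 ℤ.* d)) (d ℤ.* d)
      ratio-a-denominator = ratio-* (ratio-affine+ (ratio-c 2) (ratio-c 1)) (ratio-affine- (ratio-c 2) (ratio-c 1))

      ratio-b-denominator : IsRatio (x * (x - c 1) * (c 2 * x - c 1) * (c 2 * x - c 1))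
        (n ℤ.* (n ℤ.- d) ℤ.* (+ 2 ℤ.* n ℤ.- d) ℤ.* (+ 2 ℤ.* n ℤ.- d)) (d ℤ.* d ℤ.* d ℤ.* d)
      ratio-b-denominator = ratio-reexpress
        (ratio-* (ratio-* (ratio-* r (ratio-- r (ratio-c 1))) (ratio-affine- (ratio-c 2) (ratio-c 1))) (ratio-affine- (ratio-c 2) (ratio-c 1)))
        (i*j≢0 (i*j≢0 (i*j≢0 d≢0 d≢0) d≢0) d≢0) (solve (n ∷ d ∷ []))
        where
        d≢0 : d ≢ 0ℤ
        d≢0 = denominator≢0 r

      ratio-12x- : ∀ k → IsRatio (c 12 * x - c k) (+ 12 ℤ.* n ℤ.- + k ℤ.* d) d
      ratio-12x- k = ratio-affine- (ratio-c 12) (ratio-c k)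

    ratio-a₀ : (+ 2 ℤ.* n ℤ.+ d) ℤ.* (+ 2 ℤ.* n ℤ.- d) ≢ 0ℤ →
      IsRatio (a₀ x) (+ 24 ℤ.* (+ 144 ℤ.* n ℤ.* n ℤ.- + 41 ℤ.* d ℤ.* d)) ((+ 2 ℤ.* n ℤ.+ d) ℤ.* (+ 2 ℤ.* n ℤ.- d))
    ratio-a₀ ≢0 = ratio-reexpress
      (ratio-⊘ (ratio-* (ratio-c 24) (ratio-- (ratio-* (ratio-* (ratio-c 144) r) r) (ratio-c 41))) ratio-a-denominator ≢0 (solve (n ∷ d ∷ [])))
      ≢0 (solve (n ∷ d ∷ []))

    ratio-a₂ : (+ 2 ℤ.* n ℤ.+ d) ℤ.* (+ 2 ℤ.* n ℤ.- d) ≢ 0ℤ →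
      IsRatio (a₂ x) (+ 24 ℤ.* (+ 144 ℤ.* n ℤ.* n ℤ.- + 29 ℤ.* d ℤ.* d)) ((+ 2 ℤ.* n ℤ.+ d) ℤ.* (+ 2 ℤ.* n ℤ.- d))
    ratio-a₂ ≢0 = ratio-reexpress
      (ratio-⊘ (ratio-* (ratio-c 24) (ratio-- (ratio-* (ratio-* (ratio-c 144) r) r) (ratio-c 29))) ratio-a-denominator ≢0 (solve (n ∷ d ∷ [])))
      ≢0 (solve (n ∷ d ∷ []))

    ratio-b₀ : n ℤ.* (n ℤ.- d) ℤ.* (+ 2 ℤ.* n ℤ.- d) ℤ.* (+ 2 ℤ.* n ℤ.- d) ≢ 0ℤ →
      IsRatio (b₀ x) (+ 36 ℤ.* (+ 12 ℤ.* n ℤ.- + 11 ℤ.* d) ℤ.* (+ 12 ℤ.* n ℤ.- + 7 ℤ.* d) ℤ.* (+ 12 ℤ.* n ℤ.- + 5 ℤ.* d) ℤ.* (+ 12 ℤ.* n ℤ.- + 1 ℤ.* d))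
                     (n ℤ.* (n ℤ.- d) ℤ.* (+ 2 ℤ.* n ℤ.- d) ℤ.* (+ 2 ℤ.* n ℤ.- d))
    ratio-b₀ ≢0 = ratio-reexpress
      (ratio-⊘ (ratio-* (ratio-* (ratio-* (ratio-* (ratio-c 36) (ratio-12x- 11)) (ratio-12x- 7)) (ratio-12x- 5)) (ratio-12x- 1)) ratio-b-denominator ≢0 (solve (n ∷ d ∷ [])))
      ≢0 (solve (n ∷ d ∷ []))

    ratio-b₂ : n ℤ.* (n ℤ.- d) ℤ.* (+ 2 ℤ.* n ℤ.- d) ℤ.* (+ 2 ℤ.* n ℤ.- d) ≢ 0ℤ →
      IsRatio (b₂ x) (+ 36 ℤ.* (+ 12 ℤ.* n ℤ.- + 13 ℤ.* d) ℤ.* (+ 12 ℤ.* n ℤ.- + 7 ℤ.* d) ℤ.* (+ 12 ℤ.* n ℤ.- + 5 ℤ.* d) ℤ.* (+ 12 ℤ.* n ℤ.+ + 1 ℤ.* d))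
                     (n ℤ.* (n ℤ.- d) ℤ.* (+ 2 ℤ.* n ℤ.- d) ℤ.* (+ 2 ℤ.* n ℤ.- d))
    ratio-b₂ ≢0 = ratio-reexpress
      (ratio-⊘ (ratio-* (ratio-* (ratio-* (ratio-* (ratio-c 36) (ratio-12x- 13)) (ratio-12x- 7)) (ratio-12x- 5)) (ratio-affine+ (ratio-c 12) (ratio-c 1)))
               ratio-b-denominator ≢0 (solve (n ∷ d ∷ [])))
      ≢0 (solve (n ∷ d ∷ []))

  -- The standard ring solver is far too slow on the degree-16 identities met below, so they are
  -- decided by expanding both sides into dense coefficient lists and comparing by evaluation.

  infixl 6 _:+_ _:-_
  infixl 7 _:*_
  infix 8 :-_

  data Expr : Set where
    V : Expr
    K : ℤ → Expr
    _:+_ _:-_ _:*_ : Expr → Expr → Expr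
    :-_ : Expr → Expr

  ⟦_⟧ : Expr → ℤ → ℤ
  ⟦ V ⟧      z = z
  ⟦ K k ⟧    z = k
  ⟦ e :+ f ⟧ z = ⟦ e ⟧ z ℤ.+ ⟦ f ⟧ z
  ⟦ e :- f ⟧ z = ⟦ e ⟧ z ℤ.- ⟦ f ⟧ z
  ⟦ e :* f ⟧ z = ⟦ e ⟧ z ℤ.* ⟦ f ⟧ z
  ⟦ :- e ⟧   z = ℤ.- ⟦ e ⟧ z

  infixl 9 _[V≔_]
  _[V≔_] : Expr → Expr → Expr
  V [V≔ w ]        = w
  K k [V≔ w ]      = K k
  (e :+ f) [V≔ w ] = (e [V≔ w ]) :+ (f [V≔ w ])
  (e :- f) [V≔ w ] = (e [V≔ w ]) :- (f [V≔ w ])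
  (e :* f) [V≔ w ] = (e [V≔ w ]) :* (f [V≔ w ])
  (:- e) [V≔ w ]   = :- (e [V≔ w ])

  ⟦⟧-[V≔] : ∀ e w z → ⟦ e [V≔ w ] ⟧ z ≡ ⟦ e ⟧ (⟦ w ⟧ z)
  ⟦⟧-[V≔] V        w z = refl
  ⟦⟧-[V≔] (K k)    w z = refl
  ⟦⟧-[V≔] (e :+ f) w z = cong₂ ℤ._+_ (⟦⟧-[V≔] e w z) (⟦⟧-[V≔] f w z)
  ⟦⟧-[V≔] (e :- f) w z = cong₂ ℤ._-_ (⟦⟧-[V≔] e w z) (⟦⟧-[V≔] f w z)
  ⟦⟧-[V≔] (e :* f) w z = cong₂ ℤ._*_ (⟦⟧-[V≔] e w z) (⟦⟧-[V≔] f w z)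
  ⟦⟧-[V≔] (:- e)   w z = cong ℤ.-_ (⟦⟧-[V≔] e w z)

  infixl 6 _⊞_
  infixl 7 _⊠_

  _⊞_ : List ℤ → List ℤ → List ℤ
  []      ⊞ q       = q
  (a ∷ p) ⊞ []      = a ∷ p
  (a ∷ p) ⊞ (b ∷ q) = a ℤ.+ b ∷ p ⊞ q

  scale : ℤ → List ℤ → List ℤ
  scale k []      = []
  scale k (a ∷ p) = k ℤ.* a ∷ scale k p

  _⊠_ : List ℤ → List ℤ → List ℤ
  []      ⊠ q = []
  (a ∷ p) ⊠ q = scale a q ⊞ (0ℤ ∷ p ⊠ q)

  horner : List ℤ → ℤ → ℤ
  horner []      z = 0ℤ
  horner (a ∷ p) z = a ℤ.+ z ℤ.* horner p z

  expand : Expr → List ℤ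
  expand V        = 0ℤ ∷ 1ℤ ∷ []
  expand (K k)    = k ∷ []
  expand (e :+ f) = expand e ⊞ expand f
  expand (e :- f) = expand e ⊞ scale (ℤ.- 1ℤ) (expand f)
  expand (e :* f) = expand e ⊠ expand f
  expand (:- e)   = scale (ℤ.- 1ℤ) (expand e)

  horner-⊞ : ∀ p q z → horner (p ⊞ q) z ≡ horner p z ℤ.+ horner q z
  horner-⊞ []      q       z = sym (ℤ.+-identityˡ _)
  horner-⊞ (a ∷ p) []      z = sym (ℤ.+-identityʳ _)
  horner-⊞ (a ∷ p) (b ∷ q) z = trans (cong (λ h → a ℤ.+ b ℤ.+ z ℤ.* h) (horner-⊞ p q z)) (regroup a b z _ _)
    where
    regroup : ∀ a b z u v → a ℤ.+ b ℤ.+ z ℤ.* (u ℤ.+ v) ≡ a ℤ.+ z ℤ.* u ℤ.+ (b ℤ.+ z ℤ.* v)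
    regroup = solve-∀

  horner-scale : ∀ k p z → horner (scale k p) z ≡ k ℤ.* horner p z
  horner-scale k []      z = sym (ℤ.*-zeroʳ k)
  horner-scale k (a ∷ p) z = trans (cong (λ h → k ℤ.* a ℤ.+ z ℤ.* h) (horner-scale k p z)) (regroup k a z _)
    where
    regroup : ∀ k a z u → k ℤ.* a ℤ.+ z ℤ.* (k ℤ.* u) ≡ k ℤ.* (a ℤ.+ z ℤ.* u)
    regroup = solve-∀

  horner-⊠ : ∀ p q z → horner (p ⊠ q) z ≡ horner p z ℤ.* horner q z
  horner-⊠ []      q z = refl
  horner-⊠ (a ∷ p) q z = begin
    horner (scale a q ⊞ (0ℤ ∷ p ⊠ q)) z                                ≡⟨ horner-⊞ (scale a q) _ z ⟩
    horner (scale a q) z ℤ.+ (0ℤ ℤ.+ z ℤ.* horner (p ⊠ q) z)          ≡⟨ cong₂ (λ u v → u ℤ.+ (0ℤ ℤ.+ z ℤ.* v)) (horner-scale a q z) (horner-⊠ p q z) ⟩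
    a ℤ.* horner q z ℤ.+ (0ℤ ℤ.+ z ℤ.* (horner p z ℤ.* horner q z))   ≡⟨ regroup a z _ _ ⟩
    (a ℤ.+ z ℤ.* horner p z) ℤ.* horner q z                            ∎
    where
    open ≡-Reasoning
    regroup : ∀ a z u v → a ℤ.* v ℤ.+ (0ℤ ℤ.+ z ℤ.* (u ℤ.* v)) ≡ (a ℤ.+ z ℤ.* u) ℤ.* v
    regroup = solve-∀

  horner-expand : ∀ e z → horner (expand e) z ≡ ⟦ e ⟧ z
  horner-expand V        z = linear z
    where
    linear : ∀ z → 0ℤ ℤ.+ z ℤ.* (1ℤ ℤ.+ z ℤ.* 0ℤ) ≡ z
    linear = solve-∀
  horner-expand (K k)    z = trans (cong (ℤ._+_ k) (ℤ.*-zeroʳ z)) (ℤ.+-identityʳ k)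
  horner-expand (e :+ f) z = trans (horner-⊞ (expand e) _ z) (cong₂ ℤ._+_ (horner-expand e z) (horner-expand f z))
  horner-expand (e :- f) z = begin
    horner (expand e ⊞ scale (ℤ.- 1ℤ) (expand f)) z                  ≡⟨ horner-⊞ (expand e) _ z ⟩
    horner (expand e) z ℤ.+ horner (scale (ℤ.- 1ℤ) (expand f)) z     ≡⟨ cong (ℤ._+_ (horner (expand e) z)) (horner-scale (ℤ.- 1ℤ) (expand f) z) ⟩
    horner (expand e) z ℤ.+ ℤ.- 1ℤ ℤ.* horner (expand f) z           ≡⟨ cong₂ (λ u v → u ℤ.+ ℤ.- 1ℤ ℤ.* v) (horner-expand e z) (horner-expand f z) ⟩
    ⟦ e ⟧ z ℤ.+ ℤ.- 1ℤ ℤ.* ⟦ f ⟧ z                                   ≡⟨ minus (⟦ e ⟧ z) (⟦ f ⟧ z) ⟩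
    ⟦ e ⟧ z ℤ.- ⟦ f ⟧ z                                               ∎
    where
    open ≡-Reasoning
    minus : ∀ u v → u ℤ.+ ℤ.- 1ℤ ℤ.* v ≡ u ℤ.- v
    minus = solve-∀
  horner-expand (e :* f) z = trans (horner-⊠ (expand e) _ z) (cong₂ ℤ._*_ (horner-expand e z) (horner-expand f z))
  horner-expand (:- e)   z = trans (horner-scale (ℤ.- 1ℤ) (expand e) z) (trans (cong (ℤ._*_ (ℤ.- 1ℤ)) (horner-expand e z)) (ℤ.-1*i≡-i (⟦ e ⟧ z)))

  allZero : List ℤ → Bool
  allZero []      = true
  allZero (a ∷ p) = does (a ℤ.≟ 0ℤ) ∧ allZero p

  horner-allZero : ∀ p z → T (allZero p) → horner p z ≡ 0ℤ
  horner-allZero []      z _ = refl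
  horner-allZero (a ∷ p) z t with a ℤ.≟ 0ℤ
  ... | yes refl = trans (cong (λ h → 0ℤ ℤ.+ z ℤ.* h) (horner-allZero p z t)) (trans (ℤ.+-identityˡ _) (ℤ.*-zeroʳ z))

  infix 4 _≐_
  _≐_ : Expr → Expr → Set
  e ≐ f = T (allZero (expand (e :- f)))

  ≐-sound : ∀ e f → e ≐ f → ∀ z → ⟦ e ⟧ z ≡ ⟦ f ⟧ z
  ≐-sound e f e≐f z = ℤ.i-j≡0⇒i≡j (⟦ e ⟧ z) (⟦ f ⟧ z)
    (trans (sym (horner-expand (e :- f) z)) (horner-allZero (expand (e :- f)) z e≐f))

  record IsRatioAt (z : ℤ) (x : ℚ) (N D : Expr) : Set where
    constructor ⟨_⟩
    field ratioAt : IsRatio x (⟦ N ⟧ z) (⟦ D ⟧ z)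
  open IsRatioAt

  module _ {z : ℤ} where
    infixl 6 _⟨+⟩_ _⟨-⟩_
    infixl 7 _⟨*⟩_
    infix 8 ⟨-⟩_

    _⟨+⟩_ : ∀ {x y N₁ D₁ N₂ D₂} → IsRatioAt z x N₁ D₁ → IsRatioAt z y N₂ D₂ → IsRatioAt z (x + y) (N₁ :* D₂ :+ N₂ :* D₁) (D₁ :* D₂)
    ⟨ r₁ ⟩ ⟨+⟩ ⟨ r₂ ⟩ = ⟨ ratio-+ r₁ r₂ ⟩

    _⟨-⟩_ : ∀ {x y N₁ D₁ N₂ D₂} → IsRatioAt z x N₁ D₁ → IsRatioAt z y N₂ D₂ → IsRatioAt z (x - y) (N₁ :* D₂ :+ :- N₂ :* D₁) (D₁ :* D₂)
    ⟨ r₁ ⟩ ⟨-⟩ ⟨ r₂ ⟩ = ⟨ ratio-- r₁ r₂ ⟩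

    _⟨*⟩_ : ∀ {x y N₁ D₁ N₂ D₂} → IsRatioAt z x N₁ D₁ → IsRatioAt z y N₂ D₂ → IsRatioAt z (x * y) (N₁ :* N₂) (D₁ :* D₂)
    ⟨ r₁ ⟩ ⟨*⟩ ⟨ r₂ ⟩ = ⟨ ratio-* r₁ r₂ ⟩

    ⟨-⟩_ : ∀ {x N D} → IsRatioAt z x N D → IsRatioAt z (- x) (:- N) D
    ⟨-⟩ ⟨ r ⟩ = ⟨ ratio-neg r ⟩

    ≡-by-expansion : ∀ {x y N₁ D₁ N₂ D₂} → IsRatioAt z x N₁ D₁ → IsRatioAt z y N₂ D₂ → N₁ :* D₂ ≐ N₂ :* D₁ → x ≡ y
    ≡-by-expansion {N₁ = N₁} {D₁} {N₂} {D₂} ⟨ r₁ ⟩ ⟨ r₂ ⟩ cross = ≡-by-ratios r₁ r₂ (≐-sound (N₁ :* D₂) (N₂ :* D₁) cross z)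

    reexpressAt : ∀ {x N D N′ D′} → IsRatioAt z x N D → ⟦ D′ ⟧ z ≢ 0ℤ → N :* D′ ≐ N′ :* D → IsRatioAt z x N′ D′
    reexpressAt {N = N} {D} {N′} {D′} ⟨ r ⟩ D′≢0 cross = ⟨ ratio-reexpress r D′≢0 (≐-sound (N :* D′) (N′ :* D) cross z) ⟩

    ≢0-by-expansion : ∀ e f → e ≐ f → ⟦ f ⟧ z ≢ 0ℤ → ⟦ e ⟧ z ≢ 0ℤ
    ≢0-by-expansion e f e≐f f≢0 = f≢0 ∘ trans (sym (≐-sound e f e≐f z))

    ratioAt-0ℚ : IsRatioAt z 0ℚ (K 0ℤ) (K 1ℤ)
    ratioAt-0ℚ = ⟨ ratio-fromℤ 0ℤ ⟩

    ratioAt-const : ∀ n → IsRatioAt z (c n) (K (+ n)) (K 1ℤ)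
    ratioAt-const n = ⟨ ratio-c n ⟩

    ratioAt-½ : IsRatioAt z ½ (K 1ℤ) (K (+ 2))
    ratioAt-½ = ⟨ ratio-½ ⟩

    ratioAt-c : ∀ {n} → z ≡ + n → IsRatioAt z (c n) V (K 1ℤ)
    ratioAt-c refl = ⟨ ratio-c _ ⟩

    ratioAt-c+½ : ∀ {n} → z ≡ + n → IsRatioAt z (c n + ½) (K (+ 2) :* V :+ K 1ℤ) (K (+ 2))
    ratioAt-c+½ z≡n = reexpressAt (ratioAt-c z≡n ⟨+⟩ ratioAt-½) (λ ()) tt

    module _ {x N D} (r : IsRatioAt z x N D) where
      ratioAt-a₀ : ⟦ (K (+ 2) :* N :+ D) :* (K (+ 2) :* N :- D) ⟧ z ≢ 0ℤ →
        IsRatioAt z (a₀ x) (K (+ 24) :* (K (+ 144) :* N :* N :- K (+ 41) :* D :* D)) ((K (+ 2) :* N :+ D) :* (K (+ 2) :* N :- D))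
      ratioAt-a₀ ≢0 = ⟨ ratio-a₀ (ratioAt r) ≢0 ⟩

      ratioAt-a₂ : ⟦ (K (+ 2) :* N :+ D) :* (K (+ 2) :* N :- D) ⟧ z ≢ 0ℤ →
        IsRatioAt z (a₂ x) (K (+ 24) :* (K (+ 144) :* N :* N :- K (+ 29) :* D :* D)) ((K (+ 2) :* N :+ D) :* (K (+ 2) :* N :- D))
      ratioAt-a₂ ≢0 = ⟨ ratio-a₂ (ratioAt r) ≢0 ⟩

      ratioAt-b₀ : ⟦ N :* (N :- D) :* (K (+ 2) :* N :- D) :* (K (+ 2) :* N :- D) ⟧ z ≢ 0ℤ →
        IsRatioAt z (b₀ x)
          (K (+ 36) :* (K (+ 12) :* N :- K (+ 11) :* D) :* (K (+ 12) :* N :- K (+ 7) :* D) :* (K (+ 12) :* N :- K (+ 5) :* D) :* (K (+ 12) :* N :- K (+ 1) :* D))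
          (N :* (N :- D) :* (K (+ 2) :* N :- D) :* (K (+ 2) :* N :- D))
      ratioAt-b₀ ≢0 = ⟨ ratio-b₀ (ratioAt r) ≢0 ⟩

      ratioAt-b₂ : ⟦ N :* (N :- D) :* (K (+ 2) :* N :- D) :* (K (+ 2) :* N :- D) ⟧ z ≢ 0ℤ →
        IsRatioAt z (b₂ x)
          (K (+ 36) :* (K (+ 12) :* N :- K (+ 13) :* D) :* (K (+ 12) :* N :- K (+ 7) :* D) :* (K (+ 12) :* N :- K (+ 5) :* D) :* (K (+ 12) :* N :+ K (+ 1) :* D))
          (N :* (N :- D) :* (K (+ 2) :* N :- D) :* (K (+ 2) :* N :- D))
      ratioAt-b₂ ≢0 = ⟨ ratio-b₂ (ratioAt r) ≢0 ⟩

  shiftAt : ∀ {z x N D} m → IsRatioAt (+ m ℤ.+ z) x N D → IsRatioAt z x (N [V≔ K (+ m) :+ V ]) (D [V≔ K (+ m) :+ V ])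
  shiftAt {z} {N = N} {D} m ⟨ r ⟩ = ⟨ subst₂ (IsRatio _) (sym (⟦⟧-[V≔] N _ z)) (sym (⟦⟧-[V≔] D _ z)) r ⟩

  module _ {k w} (w≡1+k : w ≡ + suc k) where
    w≢0 : w ≢ 0ℤ
    w≢0 = subst (_≢ 0ℤ) (sym w≡1+k) (λ ())

    w+1≢0 : w ℤ.+ 1ℤ ≢ 0ℤ
    w+1≢0 = subst (λ v → v ℤ.+ 1ℤ ≢ 0ℤ) (sym w≡1+k) (λ ())

    2w+1≢0 : + 2 ℤ.* w ℤ.+ 1ℤ ≢ 0ℤ
    2w+1≢0 = subst (λ v → + 2 ℤ.* v ℤ.+ 1ℤ ≢ 0ℤ) (sym w≡1+k) (λ ())

    2w-1≢0 : + 2 ℤ.* w ℤ.- 1ℤ ≢ 0ℤ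
    2w-1≢0 = subst (λ v → + 2 ℤ.* v ℤ.- 1ℤ ≢ 0ℤ) (sym w≡1+k) (λ eq → ℕ.m+1+n≢0 k (ℤ.+-injective eq))

  w-1≢0 : ∀ {k w} → w ≡ + suc (suc k) → w ℤ.- 1ℤ ≢ 0ℤ
  w-1≢0 w≡2+k = subst (λ v → v ℤ.- 1ℤ ≢ 0ℤ) (sym w≡2+k) (λ ())

  module _ {z k} (z≡1+k : z ≡ + suc k) where
    private
      2V+1 : Expr
      2V+1 = K (+ 2) :* V :+ K 1ℤ

      [2w+1][2w-1]≢0 : ⟦ (K (+ 2) :* V :+ K 1ℤ) :* (K (+ 2) :* V :- K 1ℤ) ⟧ z ≢ 0ℤ
      [2w+1][2w-1]≢0 = i*j≢0 (2w+1≢0 z≡1+k) (2w-1≢0 z≡1+k)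

      w[w+1]≢0 : ⟦ V :* (V :+ K 1ℤ) ⟧ z ≢ 0ℤ
      w[w+1]≢0 = i*j≢0 (w≢0 z≡1+k) (w+1≢0 z≡1+k)

      w²[2w+1][2w-1]≢0 : ⟦ V :* V :* (K (+ 2) :* V :+ K 1ℤ) :* (K (+ 2) :* V :- K 1ℤ) ⟧ z ≢ 0ℤ
      w²[2w+1][2w-1]≢0 = i*j≢0 (i*j≢0 (i*j≢0 (w≢0 z≡1+k) (w≢0 z≡1+k)) (2w+1≢0 z≡1+k)) (2w-1≢0 z≡1+k)

      a-denominator≢0 : ⟦ (K (+ 2) :* 2V+1 :+ K (+ 2)) :* (K (+ 2) :* 2V+1 :- K (+ 2)) ⟧ z ≢ 0ℤ
      a-denominator≢0 = ≢0-by-expansion {z} ((K (+ 2) :* 2V+1 :+ K (+ 2)) :* (K (+ 2) :* 2V+1 :- K (+ 2))) (K (+ 16) :* (V :* (V :+ K 1ℤ))) tt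
        (i*j≢0 {+ 16} (λ ()) w[w+1]≢0)

      b-denominator≢0 : ⟦ 2V+1 :* (2V+1 :- K (+ 2)) :* (K (+ 2) :* 2V+1 :- K (+ 2)) :* (K (+ 2) :* 2V+1 :- K (+ 2)) ⟧ z ≢ 0ℤ
      b-denominator≢0 = ≢0-by-expansion {z} (2V+1 :* (2V+1 :- K (+ 2)) :* (K (+ 2) :* 2V+1 :- K (+ 2)) :* (K (+ 2) :* 2V+1 :- K (+ 2)))
        (K (+ 16) :* (V :* V :* (K (+ 2) :* V :+ K 1ℤ) :* (K (+ 2) :* V :- K 1ℤ))) tt (i*j≢0 {+ 16} (λ ()) w²[2w+1][2w-1]≢0)

    ratioAt-a[,0] : IsRatioAt z a[ suc k ,0] (K (+ 24) :* (K (+ 144) :* V :* V :- K (+ 41))) ((K (+ 2) :* V :+ K 1ℤ) :* (K (+ 2) :* V :- K 1ℤ))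
    ratioAt-a[,0] = reexpressAt (ratioAt-a₀ (ratioAt-c z≡1+k) [2w+1][2w-1]≢0) [2w+1][2w-1]≢0 tt

    ratioAt-a[,2] : IsRatioAt z a[ suc k ,2] (K (+ 24) :* (K (+ 144) :* V :* V :- K (+ 29))) ((K (+ 2) :* V :+ K 1ℤ) :* (K (+ 2) :* V :- K 1ℤ))
    ratioAt-a[,2] = reexpressAt (ratioAt-a₂ (ratioAt-c z≡1+k) [2w+1][2w-1]≢0) [2w+1][2w-1]≢0 tt

    ratioAt-a[,6] : IsRatioAt z a[ suc k ,6] (K (+ 6) :* (K (+ 144) :* V :* V :+ K (+ 144) :* V :- K (+ 5))) (V :* (V :+ K 1ℤ))
    ratioAt-a[,6] = reexpressAt (ratioAt-a₀ (ratioAt-c+½ z≡1+k) a-denominator≢0) w[w+1]≢0 tt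

    ratioAt-a[,8] : IsRatioAt z a[ suc k ,8] (K (+ 6) :* (K (+ 144) :* V :* V :+ K (+ 144) :* V :+ K (+ 7))) (V :* (V :+ K 1ℤ))
    ratioAt-a[,8] = reexpressAt (ratioAt-a₂ (ratioAt-c+½ z≡1+k) a-denominator≢0) w[w+1]≢0 tt

    ratioAt-b[,6] : IsRatioAt z b[ suc k ,6]
      (K (+ 36) :* (K (+ 12) :* V :- K (+ 5)) :* (K (+ 12) :* V :- K 1ℤ) :* (K (+ 12) :* V :+ K 1ℤ) :* (K (+ 12) :* V :+ K (+ 5)))
      (V :* V :* (K (+ 2) :* V :+ K 1ℤ) :* (K (+ 2) :* V :- K 1ℤ))
    ratioAt-b[,6] = reexpressAt (ratioAt-b₀ (ratioAt-c+½ z≡1+k) b-denominator≢0) w²[2w+1][2w-1]≢0 tt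

    ratioAt-b[,8] : IsRatioAt z b[ suc k ,8]
      (K (+ 36) :* (K (+ 12) :* V :- K (+ 7)) :* (K (+ 12) :* V :- K 1ℤ) :* (K (+ 12) :* V :+ K 1ℤ) :* (K (+ 12) :* V :+ K (+ 7)))
      (V :* V :* (K (+ 2) :* V :+ K 1ℤ) :* (K (+ 2) :* V :- K 1ℤ))
    ratioAt-b[,8] = reexpressAt (ratioAt-b₂ (ratioAt-c+½ z≡1+k) b-denominator≢0) w²[2w+1][2w-1]≢0 tt

  module _ {z k} (z≡2+k : z ≡ + suc (suc k)) where
    private
      w[w-1][2w-1]²≢0 : ⟦ V :* (V :- K 1ℤ) :* (K (+ 2) :* V :- K 1ℤ) :* (K (+ 2) :* V :- K 1ℤ) ⟧ z ≢ 0ℤ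
      w[w-1][2w-1]²≢0 = i*j≢0 (i*j≢0 (i*j≢0 (w≢0 z≡2+k) (w-1≢0 z≡2+k)) (2w-1≢0 z≡2+k)) (2w-1≢0 z≡2+k)

    ratioAt-b[,0] : IsRatioAt z b[ suc (suc k) ,0]
      (K (+ 36) :* (K (+ 12) :* V :- K (+ 11)) :* (K (+ 12) :* V :- K (+ 7)) :* (K (+ 12) :* V :- K (+ 5)) :* (K (+ 12) :* V :- K 1ℤ))
      (V :* (V :- K 1ℤ) :* (K (+ 2) :* V :- K 1ℤ) :* (K (+ 2) :* V :- K 1ℤ))
    ratioAt-b[,0] = reexpressAt (ratioAt-b₀ (ratioAt-c z≡2+k) w[w-1][2w-1]²≢0) w[w-1][2w-1]²≢0 tt

    ratioAt-b[,2] : IsRatioAt z b[ suc (suc k) ,2]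
      (K (+ 36) :* (K (+ 12) :* V :- K (+ 13)) :* (K (+ 12) :* V :- K (+ 7)) :* (K (+ 12) :* V :- K (+ 5)) :* (K (+ 12) :* V :+ K 1ℤ))
      (V :* (V :- K 1ℤ) :* (K (+ 2) :* V :- K 1ℤ) :* (K (+ 2) :* V :- K 1ℤ))
    ratioAt-b[,2] = reexpressAt (ratioAt-b₂ (ratioAt-c z≡2+k) w[w-1][2w-1]²≢0) w[w-1][2w-1]²≢0 tt

  -- Opaque, so that unification can read N and D back from a coefficient defined with it.
  opaque
    rational : Expr → Expr → ℕ → ℚ
    rational N D n = fromℤ (⟦ N ⟧ (+ n)) ⊘ fromℤ (⟦ D ⟧ (+ n))

  opaque
    unfolding rational

    ratioAt-rational : ∀ {N D n z} → z ≡ + n → ⟦ D ⟧ z ≢ 0ℤ → IsRatioAt z (rational N D n) N D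
    ratioAt-rational refl D≢0 =
      ⟨ subst₂ (IsRatio _) (ℤ.*-identityʳ _) (ℤ.*-identityˡ _) (ratio-⊘ (ratio-fromℤ _) (ratio-fromℤ _) D≢0 refl) ⟩

    rational-unfold : ∀ {N D n} → rational N D n ≡ fromℤ (⟦ N ⟧ (+ n)) ⊘ fromℤ (⟦ D ⟧ (+ n))
    rational-unfold = refl

  -- The coefficients of the relations
  --   A_{n,2} = A_{n,6} + γ₂₆(n) A_{n-1,6}          A_{n+1,2} = X A_{n,6} + κ₂₆(n) A_{n,2}
  --   A_{n,2} = A_{n,8} + γ₂₈(n) A_{n-1,8}          A_{n+1,2} = (X - 1728) A_{n,8} + κ₂₈(n) A_{n,2}
  --   A_{n,6} = A_{n+1,0} + γ₆₀(n) A_{n,0}          A_{n,8} = X A_{n,0} + κ₈₀(n) A_{n-1,8}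
  --   A_{n,8} = A_{n+1,0} + γ₈₀(n) A_{n,0}          A_{n,6} = (X - 1728) A_{n,0} + κ₆₀(n) A_{n-1,6}
  γ₂₆ γ₂₈ γ₆₀ γ₈₀ κ₂₆ κ₂₈ κ₈₀ κ₆₀ : ℕ → ℚ
  γ₂₆ = rational (K (+ 6) :* (K (+ 12) :* V :+ K 1ℤ) :* (K (+ 12) :* V :- K (+ 5))) (V :* (K (+ 2) :* V :- K 1ℤ))
  γ₂₈ = rational (K (ℤ.- + 6) :* (K (+ 12) :* V :+ K 1ℤ) :* (K (+ 12) :* V :- K (+ 7))) (V :* (K (+ 2) :* V :- K 1ℤ))
  γ₆₀ = rational (K (ℤ.- + 6) :* (K (+ 12) :* V :+ K 1ℤ) :* (K (+ 12) :* V :+ K (+ 5))) (V :* (K (+ 2) :* V :+ K 1ℤ))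
  γ₈₀ = rational (K (+ 6) :* (K (+ 12) :* V :+ K 1ℤ) :* (K (+ 12) :* V :+ K (+ 7))) (V :* (K (+ 2) :* V :+ K 1ℤ))
  κ₂₆ = rational (K (ℤ.- + 6) :* (K (+ 12) :* V :- K 1ℤ) :* (K (+ 12) :* V :+ K (+ 5))) (V :* (K (+ 2) :* V :+ K 1ℤ))
  κ₂₈ = rational (K (+ 6) :* (K (+ 12) :* V :- K 1ℤ) :* (K (+ 12) :* V :+ K (+ 7))) (V :* (K (+ 2) :* V :+ K 1ℤ))
  κ₈₀ = rational (K (ℤ.- + 6) :* (K (+ 12) :* V :- K (+ 7)) :* (K (+ 12) :* V :- K 1ℤ)) (V :* (K (+ 2) :* V :- K 1ℤ))
  κ₆₀ = rational (K (+ 6) :* (K (+ 12) :* V :- K (+ 5)) :* (K (+ 12) :* V :- K 1ℤ)) (V :* (K (+ 2) :* V :- K 1ℤ))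

  module _ {z k} (z≡1+k : z ≡ + suc k) where
    private
      w[2w+1]≢0 : ⟦ V :* (K (+ 2) :* V :+ K 1ℤ) ⟧ z ≢ 0ℤ
      w[2w+1]≢0 = i*j≢0 (w≢0 z≡1+k) (2w+1≢0 z≡1+k)

      w[2w-1]≢0 : ⟦ V :* (K (+ 2) :* V :- K 1ℤ) ⟧ z ≢ 0ℤ
      w[2w-1]≢0 = i*j≢0 (w≢0 z≡1+k) (2w-1≢0 z≡1+k)

    ratioAt-γ₂₆ : IsRatioAt z (γ₂₆ (suc k)) (K (+ 6) :* (K (+ 12) :* V :+ K 1ℤ) :* (K (+ 12) :* V :- K (+ 5))) (V :* (K (+ 2) :* V :- K 1ℤ))
    ratioAt-γ₂₆ = ratioAt-rational z≡1+k w[2w-1]≢0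

    ratioAt-γ₂₈ : IsRatioAt z (γ₂₈ (suc k)) (K (ℤ.- + 6) :* (K (+ 12) :* V :+ K 1ℤ) :* (K (+ 12) :* V :- K (+ 7))) (V :* (K (+ 2) :* V :- K 1ℤ))
    ratioAt-γ₂₈ = ratioAt-rational z≡1+k w[2w-1]≢0

    ratioAt-γ₆₀ : IsRatioAt z (γ₆₀ (suc k)) (K (ℤ.- + 6) :* (K (+ 12) :* V :+ K 1ℤ) :* (K (+ 12) :* V :+ K (+ 5))) (V :* (K (+ 2) :* V :+ K 1ℤ))
    ratioAt-γ₆₀ = ratioAt-rational z≡1+k w[2w+1]≢0

    ratioAt-γ₈₀ : IsRatioAt z (γ₈₀ (suc k)) (K (+ 6) :* (K (+ 12) :* V :+ K 1ℤ) :* (K (+ 12) :* V :+ K (+ 7))) (V :* (K (+ 2) :* V :+ K 1ℤ))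
    ratioAt-γ₈₀ = ratioAt-rational z≡1+k w[2w+1]≢0

    ratioAt-κ₂₆ : IsRatioAt z (κ₂₆ (suc k)) (K (ℤ.- + 6) :* (K (+ 12) :* V :- K 1ℤ) :* (K (+ 12) :* V :+ K (+ 5))) (V :* (K (+ 2) :* V :+ K 1ℤ))
    ratioAt-κ₂₆ = ratioAt-rational z≡1+k w[2w+1]≢0

    ratioAt-κ₂₈ : IsRatioAt z (κ₂₈ (suc k)) (K (+ 6) :* (K (+ 12) :* V :- K 1ℤ) :* (K (+ 12) :* V :+ K (+ 7))) (V :* (K (+ 2) :* V :+ K 1ℤ))
    ratioAt-κ₂₈ = ratioAt-rational z≡1+k w[2w+1]≢0

    ratioAt-κ₈₀ : IsRatioAt z (κ₈₀ (suc k)) (K (ℤ.- + 6) :* (K (+ 12) :* V :- K (+ 7)) :* (K (+ 12) :* V :- K 1ℤ)) (V :* (K (+ 2) :* V :- K 1ℤ))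
    ratioAt-κ₈₀ = ratioAt-rational z≡1+k w[2w-1]≢0

    ratioAt-κ₆₀ : IsRatioAt z (κ₆₀ (suc k)) (K (+ 6) :* (K (+ 12) :* V :- K (+ 5)) :* (K (+ 12) :* V :- K 1ℤ)) (V :* (K (+ 2) :* V :- K 1ℤ))
    ratioAt-κ₆₀ = ratioAt-rational z≡1+k w[2w-1]≢0

  shift : (ℕ → ℚ) → ℕ → ℚ
  shift f zero    = 0ℚ
  shift f (suc i) = f i

  mulX- : ℚ → (ℕ → ℚ) → ℕ → ℚ
  mulX- a f i = shift f i - a * f i

  coeff-⊕ : ∀ P Q i → coeff (P ⊕ Q) i ≡ coeff P i + coeff Q i
  coeff-⊕ []      Q       i       = sym (ℚ.+-identityˡ _)
  coeff-⊕ (a ∷ P) []      zero    = sym (ℚ.+-identityʳ a)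
  coeff-⊕ (a ∷ P) []      (suc i) = sym (ℚ.+-identityʳ _)
  coeff-⊕ (a ∷ P) (b ∷ Q) zero    = refl
  coeff-⊕ (a ∷ P) (b ∷ Q) (suc i) = coeff-⊕ P Q i

  coeff-· : ∀ k P i → coeff (k · P) i ≡ k * coeff P i
  coeff-· k []      i       = sym (ℚ.*-zeroʳ k)
  coeff-· k (a ∷ P) zero    = refl
  coeff-· k (a ∷ P) (suc i) = coeff-· k P i

  coeff-⊖ : ∀ P Q i → coeff (P ⊖ Q) i ≡ coeff P i - coeff Q i
  coeff-⊖ P Q i = trans (coeff-⊕ P _ i) (trans (cong (_+_ (coeff P i)) (coeff-· (- 1ℚ) Q i)) (minus (coeff P i) (coeff Q i)))
    where
    minus : ∀ x y → x + - 1ℚ * y ≡ x - y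
    minus = RingSolver.solve-∀ ℚ-ring

  coeff-∷⊛ : ∀ a P Q i → coeff ((a ∷ P) ⊛ Q) i ≡ a * coeff Q i + shift (coeff (P ⊛ Q)) i
  coeff-∷⊛ a P Q zero    = trans (coeff-⊕ (a · Q) _ zero) (cong (_+ 0ℚ) (coeff-· a Q zero))
  coeff-∷⊛ a P Q (suc i) = trans (coeff-⊕ (a · Q) _ (suc i)) (cong (_+ coeff (P ⊛ Q) i) (coeff-· a Q (suc i)))

  coeff-C⊛ : ∀ a Q i → coeff (C a ⊛ Q) i ≡ a * coeff Q i
  coeff-C⊛ a Q i = trans (coeff-∷⊛ a [] Q i) (trans (cong (_+_ (a * coeff Q i)) (shift-0 i)) (ℚ.+-identityʳ _))
    where
    shift-0 : ∀ i → shift (coeff []) i ≡ 0ℚ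
    shift-0 zero    = refl
    shift-0 (suc i) = refl

  coeff-X-⊛ : ∀ a P i → coeff (X- a ⊛ P) i ≡ mulX- a (coeff P) i
  coeff-X-⊛ a P zero    = trans (coeff-∷⊛ (- a) (1ℚ ∷ []) P zero) (regroup a (coeff P 0))
    where
    regroup : ∀ a x → - a * x + 0ℚ ≡ 0ℚ - a * x
    regroup = RingSolver.solve-∀ ℚ-ring
  coeff-X-⊛ a P (suc i) = trans (coeff-∷⊛ (- a) (1ℚ ∷ []) P (suc i))
    (trans (cong (_+_ (- a * coeff P (suc i))) (coeff-C⊛ 1ℚ P i)) (regroup a (coeff P i) (coeff P (suc i))))
    where
    regroup : ∀ a x y → - a * y + 1ℚ * x ≡ x - a * y
    regroup = RingSolver.solve-∀ ℚ-ring

  coeff-recurrence : ∀ a b P Q i → coeff ((X- a ⊛ P) ⊖ (b · Q)) i ≡ mulX- a (coeff P) i - b * coeff Q i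
  coeff-recurrence a b P Q i = trans (coeff-⊖ (X- a ⊛ P) (b · Q) i) (cong₂ _-_ (coeff-X-⊛ a P i) (coeff-· b Q i))

  record ThreeTerm (a b : ℕ → ℚ) (f : ℕ → ℕ → ℚ) : Set where
    constructor three-term
    field recurrence : ∀ k i → f (2 ℕ.+ k) i ≡ mulX- (a (1 ℕ.+ k)) (f (1 ℕ.+ k)) i - b (1 ℕ.+ k) * f k i
  open ThreeTerm

  record Combination (f g : ℕ → ℚ) (l : ℚ) (h : ℕ → ℚ) : Set where
    constructor combination
    field at : ∀ i → f i ≡ g i + l * h i
  open Combination

  shift-combination : ∀ {f g l h} → Combination f g l h → ∀ i → shift f i ≡ shift g i + l * shift h i
  shift-combination {l = l} f≡ zero    = sym (trans (cong (_+_ 0ℚ) (ℚ.*-zeroʳ l)) (ℚ.+-identityˡ 0ℚ))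
  shift-combination         f≡ (suc i) = at f≡ i

  Connected : (g : ℕ → ℚ) (F G : ℕ → ℕ → ℚ) → ℕ → Set
  Connected g F G k = Combination (F k) (G (suc k)) (g k) (G k)

  -- Expanding F_{k+2} and G_{k+3} + g_{k+2} G_{k+2} through both recurrences, these say that
  -- the coefficients of G_{k+2}, G_{k+1} and G_k agree.
  record Compatible (aF bF aG bG g : ℕ → ℚ) : Set where
    field
      at-G₂ : ∀ k → g (1 ℕ.+ k) - aF (1 ℕ.+ k) ≡ g (2 ℕ.+ k) - aG (2 ℕ.+ k)
      at-G₁ : ∀ k → g (1 ℕ.+ k) * aG (1 ℕ.+ k) - aF (1 ℕ.+ k) * g (1 ℕ.+ k) - bF (1 ℕ.+ k) ≡ - bG (2 ℕ.+ k)
      at-G₀ : ∀ k → g (1 ℕ.+ k) * bG (1 ℕ.+ k) ≡ bF (1 ℕ.+ k) * g k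

  module _ {aF bF aG bG g F G} (F-rec : ThreeTerm aF bF F) (G-rec : ThreeTerm aG bG G) (compatible : Compatible aF bF aG bG g) where
    open Compatible compatible

    private
      step : ∀ k → Connected g F G k → Connected g F G (suc k) → ∀ i → F (2 ℕ.+ k) i ≡ G (3 ℕ.+ k) i + g (2 ℕ.+ k) * G (2 ℕ.+ k) i
      step k F₀≡ F₁≡ i = begin
        F (2 ℕ.+ k) i                                                        ≡⟨ recurrence F-rec k i ⟩
        shift (F (1 ℕ.+ k)) i - aF₁ * F (1 ℕ.+ k) i - bF₁ * F k i           ≡⟨ cong₂ (λ s t → s - aF₁ * t - bF₁ * F k i) (shift-combination F₁≡ i) (at F₁≡ i) ⟩
        s₂ + g₁ * s₁ - aF₁ * (G₂ + g₁ * G₁) - bF₁ * F k i                     ≡⟨ cong₂ (λ s t → s₂ + g₁ * s - aF₁ * (G₂ + g₁ * G₁) - bF₁ * t) s₁≡ (at F₀≡ i) ⟩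
        s₂ + g₁ * (G₂ + aG₁ * G₁ + bG₁ * G₀) - aF₁ * (G₂ + g₁ * G₁) - bF₁ * (G₁ + g₀ * G₀)
          ≡⟨ collect s₂ g₁ G₂ aG₁ G₁ bG₁ G₀ aF₁ bF₁ g₀ ⟩
        s₂ + (g₁ - aF₁) * G₂ + (g₁ * aG₁ - aF₁ * g₁ - bF₁) * G₁ + (g₁ * bG₁ - bF₁ * g₀) * G₀
          ≡⟨ cong₂ (λ u v → s₂ + u * G₂ + v * G₁ + (g₁ * bG₁ - bF₁ * g₀) * G₀) (at-G₂ k) (at-G₁ k) ⟩
        s₂ + (g₂ - aG₂) * G₂ + - bG₂ * G₁ + (g₁ * bG₁ - bF₁ * g₀) * G₀       ≡⟨ cong (λ u → s₂ + (g₂ - aG₂) * G₂ + - bG₂ * G₁ + (u - bF₁ * g₀) * G₀) (at-G₀ k) ⟩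
        s₂ + (g₂ - aG₂) * G₂ + - bG₂ * G₁ + (bF₁ * g₀ - bF₁ * g₀) * G₀       ≡⟨ cancel s₂ g₂ aG₂ G₂ bG₂ G₁ (bF₁ * g₀) G₀ ⟩
        s₂ - aG₂ * G₂ - bG₂ * G₁ + g₂ * G₂                                   ≡⟨ cong (_+ g₂ * G₂) (recurrence G-rec (1 ℕ.+ k) i) ⟨
        G (3 ℕ.+ k) i + g₂ * G₂                                              ∎
        where
        open ≡-Reasoning
        aF₁ bF₁ aG₁ bG₁ aG₂ bG₂ g₀ g₁ g₂ G₀ G₁ G₂ s₁ s₂ : ℚ
        aF₁ = aF (1 ℕ.+ k)
        bF₁ = bF (1 ℕ.+ k)
        aG₁ = aG (1 ℕ.+ k)
        bG₁ = bG (1 ℕ.+ k)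
        aG₂ = aG (2 ℕ.+ k)
        bG₂ = bG (2 ℕ.+ k)
        g₀ = g k
        g₁ = g (1 ℕ.+ k)
        g₂ = g (2 ℕ.+ k)
        G₀ = G k i
        G₁ = G (1 ℕ.+ k) i
        G₂ = G (2 ℕ.+ k) i
        s₁ = shift (G (1 ℕ.+ k)) i
        s₂ = shift (G (2 ℕ.+ k)) i
        s₁≡ : s₁ ≡ G₂ + aG₁ * G₁ + bG₁ * G₀
        s₁≡ = trans (solve-for s₁ (aG₁ * G₁) (bG₁ * G₀)) (cong (λ t → t + aG₁ * G₁ + bG₁ * G₀) (sym (recurrence G-rec k i)))
          where
          solve-for : ∀ s u v → s ≡ s - u - v + u + v
          solve-for = RingSolver.solve-∀ ℚ-ring
        collect : ∀ s₂ g₁ G₂ aG₁ G₁ bG₁ G₀ aF₁ bF₁ g₀ →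
          s₂ + g₁ * (G₂ + aG₁ * G₁ + bG₁ * G₀) - aF₁ * (G₂ + g₁ * G₁) - bF₁ * (G₁ + g₀ * G₀)
          ≡ s₂ + (g₁ - aF₁) * G₂ + (g₁ * aG₁ - aF₁ * g₁ - bF₁) * G₁ + (g₁ * bG₁ - bF₁ * g₀) * G₀
        collect = RingSolver.solve-∀ ℚ-ring
        cancel : ∀ s₂ g₂ aG₂ G₂ bG₂ G₁ t G₀ → s₂ + (g₂ - aG₂) * G₂ + - bG₂ * G₁ + (t - t) * G₀ ≡ s₂ - aG₂ * G₂ - bG₂ * G₁ + g₂ * G₂
        cancel = RingSolver.solve-∀ ℚ-ring

    connected : Connected g F G 0 → Connected g F G 1 → ∀ k → Connected g F G k
    connected F₀≡ F₁≡ k = proj₁ (pair k)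
      where
      pair : ∀ k → Connected g F G k × Connected g F G (suc k)
      pair zero    = F₀≡ , F₁≡
      pair (suc k) with pair k
      ... | Fₖ≡ , Fₖ₊₁≡ = Fₖ₊₁≡ , combination (step k Fₖ≡ Fₖ₊₁≡)

  record XCompatible (aG bG g κ : ℕ → ℚ) (a : ℚ) : Set where
    field
      at-G₁ : ∀ k → κ (1 ℕ.+ k) ≡ g (1 ℕ.+ k) - aG (1 ℕ.+ k) + a
      at-G₀ : ∀ k → - bG (1 ℕ.+ k) ≡ κ (1 ℕ.+ k) * g k

  x-connected : ∀ {aG bG g κ a F G} → (∀ k → Connected g F G k) → ThreeTerm aG bG G → XCompatible aG bG g κ a →
    ∀ k → Combination (F (1 ℕ.+ k)) (mulX- a (G (1 ℕ.+ k))) (κ (1 ℕ.+ k)) (F k)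
  x-connected {aG} {bG} {g} {κ} {a} {F} {G} F≡ G-rec compatible k = combination λ i → begin
    F (1 ℕ.+ k) i                                               ≡⟨ at (F≡ (1 ℕ.+ k)) i ⟩
    G (2 ℕ.+ k) i + g (1 ℕ.+ k) * G (1 ℕ.+ k) i                 ≡⟨ cong (_+ g (1 ℕ.+ k) * G (1 ℕ.+ k) i) (recurrence G-rec k i) ⟩
    mulX- (aG (1 ℕ.+ k)) (G (1 ℕ.+ k)) i - bG (1 ℕ.+ k) * G k i + g (1 ℕ.+ k) * G (1 ℕ.+ k) i
      ≡⟨ regroup (shift (G (1 ℕ.+ k)) i) (aG (1 ℕ.+ k)) (G (1 ℕ.+ k) i) (bG (1 ℕ.+ k)) (G k i) (g (1 ℕ.+ k)) a ⟩
    mulX- a (G (1 ℕ.+ k)) i + (g (1 ℕ.+ k) - aG (1 ℕ.+ k) + a) * G (1 ℕ.+ k) i + - bG (1 ℕ.+ k) * G k i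
      ≡⟨ cong₂ (λ u v → mulX- a (G (1 ℕ.+ k)) i + u * G (1 ℕ.+ k) i + v * G k i) (sym (at-G₁ k)) (at-G₀ k) ⟩
    mulX- a (G (1 ℕ.+ k)) i + κ (1 ℕ.+ k) * G (1 ℕ.+ k) i + κ (1 ℕ.+ k) * g k * G k i
      ≡⟨ factor (mulX- a (G (1 ℕ.+ k)) i) (κ (1 ℕ.+ k)) (G (1 ℕ.+ k) i) (g k) (G k i) ⟩
    mulX- a (G (1 ℕ.+ k)) i + κ (1 ℕ.+ k) * (G (1 ℕ.+ k) i + g k * G k i)
      ≡⟨ cong (λ t → mulX- a (G (1 ℕ.+ k)) i + κ (1 ℕ.+ k) * t) (at (F≡ k) i) ⟨
    mulX- a (G (1 ℕ.+ k)) i + κ (1 ℕ.+ k) * F k i               ∎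
    where
    open ≡-Reasoning
    open XCompatible compatible
    regroup : ∀ s aG₁ G₁ bG₁ G₀ g₁ a → s - aG₁ * G₁ - bG₁ * G₀ + g₁ * G₁ ≡ s - a * G₁ + (g₁ - aG₁ + a) * G₁ + - bG₁ * G₀
    regroup = RingSolver.solve-∀ ℚ-ring
    factor : ∀ t κ G₁ g G₀ → t + κ * G₁ + κ * g * G₀ ≡ t + κ * (G₁ + g * G₀)
    factor = RingSolver.solve-∀ ℚ-ring

  -- The recurrence for r = 0 holds from n = 1 on, because A_{0,0} = 0.
  A₀-recurrence : ThreeTerm a[_,0] b[_,0] (λ k → coeff A[ k ,0])
  A₀-recurrence = three-term λ where
    zero    zero          → refl
    zero    (suc zero)    → refl
    zero    (suc (suc i)) → refl
    (suc k) i             → coeff-recurrence _ _ A[ 2 ℕ.+ k ,0] A[ 1 ℕ.+ k ,0] i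

  -- Shifted by one, since the recurrence for r = 2 only starts at n = 2.
  A₂-recurrence : ThreeTerm (λ j → a[ suc j ,2]) (λ j → b[ suc j ,2]) (λ k → coeff A[ suc k ,2])
  A₂-recurrence = three-term λ k → coeff-recurrence _ _ A[ 2 ℕ.+ k ,2] A[ 1 ℕ.+ k ,2]

  A₆-recurrence : ThreeTerm a[_,6] b[_,6] (λ k → coeff A[ k ,6])
  A₆-recurrence = three-term λ k → coeff-recurrence _ _ A[ 1 ℕ.+ k ,6] A[ k ,6]

  A₈-recurrence : ThreeTerm a[_,8] b[_,8] (λ k → coeff A[ k ,8])
  A₈-recurrence = three-term λ k → coeff-recurrence _ _ A[ 1 ℕ.+ k ,8] A[ k ,8]

  γ₂₆-compatible : Compatible (λ j → a[ suc j ,2]) (λ j → b[ suc j ,2]) a[_,6] b[_,6] (λ k → γ₂₆ (suc k))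
  γ₂₆-compatible = record
    { at-G₂ = λ k → ≡-by-expansion {+ k}
        (shiftAt 2 (ratioAt-γ₂₆ refl) ⟨-⟩ shiftAt 2 (ratioAt-a[,2] refl))
        (shiftAt 3 (ratioAt-γ₂₆ refl) ⟨-⟩ shiftAt 2 (ratioAt-a[,6] refl)) tt
    ; at-G₁ = λ k → ≡-by-expansion {+ k}
        (shiftAt 2 (ratioAt-γ₂₆ refl) ⟨*⟩ shiftAt 1 (ratioAt-a[,6] refl) ⟨-⟩ shiftAt 2 (ratioAt-a[,2] refl) ⟨*⟩ shiftAt 2 (ratioAt-γ₂₆ refl)
          ⟨-⟩ shiftAt 2 (ratioAt-b[,2] refl))
        (⟨-⟩ shiftAt 2 (ratioAt-b[,6] refl)) tt
    ; at-G₀ = λ k → ≡-by-expansion {+ k}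
        (shiftAt 2 (ratioAt-γ₂₆ refl) ⟨*⟩ shiftAt 1 (ratioAt-b[,6] refl))
        (shiftAt 2 (ratioAt-b[,2] refl) ⟨*⟩ shiftAt 1 (ratioAt-γ₂₆ refl)) tt
    }

  γ₂₈-compatible : Compatible (λ j → a[ suc j ,2]) (λ j → b[ suc j ,2]) a[_,8] b[_,8] (λ k → γ₂₈ (suc k))
  γ₂₈-compatible = record
    { at-G₂ = λ k → ≡-by-expansion {+ k}
        (shiftAt 2 (ratioAt-γ₂₈ refl) ⟨-⟩ shiftAt 2 (ratioAt-a[,2] refl))
        (shiftAt 3 (ratioAt-γ₂₈ refl) ⟨-⟩ shiftAt 2 (ratioAt-a[,8] refl)) tt
    ; at-G₁ = λ k → ≡-by-expansion {+ k}
        (shiftAt 2 (ratioAt-γ₂₈ refl) ⟨*⟩ shiftAt 1 (ratioAt-a[,8] refl) ⟨-⟩ shiftAt 2 (ratioAt-a[,2] refl) ⟨*⟩ shiftAt 2 (ratioAt-γ₂₈ refl)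
          ⟨-⟩ shiftAt 2 (ratioAt-b[,2] refl))
        (⟨-⟩ shiftAt 2 (ratioAt-b[,8] refl)) tt
    ; at-G₀ = λ k → ≡-by-expansion {+ k}
        (shiftAt 2 (ratioAt-γ₂₈ refl) ⟨*⟩ shiftAt 1 (ratioAt-b[,8] refl))
        (shiftAt 2 (ratioAt-b[,2] refl) ⟨*⟩ shiftAt 1 (ratioAt-γ₂₈ refl)) tt
    }

  -- In the cases k = 0 of at-G₀ below, both sides vanish only through the convention x ⊘ 0 = 0:
  -- b[1,0], γ₆₀ 0 and γ₈₀ 0 are evaluations at poles.
  γ₆₀-compatible : Compatible a[_,6] b[_,6] a[_,0] b[_,0] γ₆₀
  γ₆₀-compatible = record
    { at-G₂ = λ k → ≡-by-expansion {+ k}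
        (shiftAt 1 (ratioAt-γ₆₀ refl) ⟨-⟩ shiftAt 1 (ratioAt-a[,6] refl))
        (shiftAt 2 (ratioAt-γ₆₀ refl) ⟨-⟩ shiftAt 2 (ratioAt-a[,0] refl)) tt
    ; at-G₁ = λ k → ≡-by-expansion {+ k}
        (shiftAt 1 (ratioAt-γ₆₀ refl) ⟨*⟩ shiftAt 1 (ratioAt-a[,0] refl) ⟨-⟩ shiftAt 1 (ratioAt-a[,6] refl) ⟨*⟩ shiftAt 1 (ratioAt-γ₆₀ refl)
          ⟨-⟩ shiftAt 1 (ratioAt-b[,6] refl))
        (⟨-⟩ shiftAt 2 (ratioAt-b[,0] refl)) tt
    ; at-G₀ = λ where
        zero    → subst₂ (λ u v → u * b[ 1 ,0] ≡ b[ 1 ,6] * v) (sym rational-unfold) (sym rational-unfold) refl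
        (suc k) → ≡-by-expansion {+ k}
          (shiftAt 2 (ratioAt-γ₆₀ refl) ⟨*⟩ shiftAt 2 (ratioAt-b[,0] refl))
          (shiftAt 2 (ratioAt-b[,6] refl) ⟨*⟩ shiftAt 1 (ratioAt-γ₆₀ refl)) tt
    }

  γ₈₀-compatible : Compatible a[_,8] b[_,8] a[_,0] b[_,0] γ₈₀
  γ₈₀-compatible = record
    { at-G₂ = λ k → ≡-by-expansion {+ k}
        (shiftAt 1 (ratioAt-γ₈₀ refl) ⟨-⟩ shiftAt 1 (ratioAt-a[,8] refl))
        (shiftAt 2 (ratioAt-γ₈₀ refl) ⟨-⟩ shiftAt 2 (ratioAt-a[,0] refl)) tt
    ; at-G₁ = λ k → ≡-by-expansion {+ k}
        (shiftAt 1 (ratioAt-γ₈₀ refl) ⟨*⟩ shiftAt 1 (ratioAt-a[,0] refl) ⟨-⟩ shiftAt 1 (ratioAt-a[,8] refl) ⟨*⟩ shiftAt 1 (ratioAt-γ₈₀ refl)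
          ⟨-⟩ shiftAt 1 (ratioAt-b[,8] refl))
        (⟨-⟩ shiftAt 2 (ratioAt-b[,0] refl)) tt
    ; at-G₀ = λ where
        zero    → subst₂ (λ u v → u * b[ 1 ,0] ≡ b[ 1 ,8] * v) (sym rational-unfold) (sym rational-unfold) refl
        (suc k) → ≡-by-expansion {+ k}
          (shiftAt 2 (ratioAt-γ₈₀ refl) ⟨*⟩ shiftAt 2 (ratioAt-b[,0] refl))
          (shiftAt 2 (ratioAt-b[,8] refl) ⟨*⟩ shiftAt 1 (ratioAt-γ₈₀ refl)) tt
    }

  κ₂₆-compatible : XCompatible a[_,6] b[_,6] (λ k → γ₂₆ (suc k)) κ₂₆ 0ℚ
  κ₂₆-compatible = record
    { at-G₁ = λ k → ≡-by-expansion {+ k}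
        (shiftAt 1 (ratioAt-κ₂₆ refl))
        (shiftAt 2 (ratioAt-γ₂₆ refl) ⟨-⟩ shiftAt 1 (ratioAt-a[,6] refl) ⟨+⟩ ratioAt-0ℚ) tt
    ; at-G₀ = λ k → ≡-by-expansion {+ k}
        (⟨-⟩ shiftAt 1 (ratioAt-b[,6] refl))
        (shiftAt 1 (ratioAt-κ₂₆ refl) ⟨*⟩ shiftAt 1 (ratioAt-γ₂₆ refl)) tt
    }

  κ₂₈-compatible : XCompatible a[_,8] b[_,8] (λ k → γ₂₈ (suc k)) κ₂₈ (c 1728)
  κ₂₈-compatible = record
    { at-G₁ = λ k → ≡-by-expansion {+ k}
        (shiftAt 1 (ratioAt-κ₂₈ refl))
        (shiftAt 2 (ratioAt-γ₂₈ refl) ⟨-⟩ shiftAt 1 (ratioAt-a[,8] refl) ⟨+⟩ ratioAt-const 1728) tt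
    ; at-G₀ = λ k → ≡-by-expansion {+ k}
        (⟨-⟩ shiftAt 1 (ratioAt-b[,8] refl))
        (shiftAt 1 (ratioAt-κ₂₈ refl) ⟨*⟩ shiftAt 1 (ratioAt-γ₂₈ refl)) tt
    }

  κ₈₀-compatible : XCompatible a[_,0] b[_,0] γ₈₀ κ₈₀ 0ℚ
  κ₈₀-compatible = record
    { at-G₁ = λ k → ≡-by-expansion {+ k}
        (shiftAt 1 (ratioAt-κ₈₀ refl))
        (shiftAt 1 (ratioAt-γ₈₀ refl) ⟨-⟩ shiftAt 1 (ratioAt-a[,0] refl) ⟨+⟩ ratioAt-0ℚ) tt
    ; at-G₀ = λ where
        zero    → subst₂ (λ u v → - b[ 1 ,0] ≡ u * v) (sym rational-unfold) (sym rational-unfold) refl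
        (suc k) → ≡-by-expansion {+ k}
          (⟨-⟩ shiftAt 2 (ratioAt-b[,0] refl))
          (shiftAt 2 (ratioAt-κ₈₀ refl) ⟨*⟩ shiftAt 1 (ratioAt-γ₈₀ refl)) tt
    }

  κ₆₀-compatible : XCompatible a[_,0] b[_,0] γ₆₀ κ₆₀ (c 1728)
  κ₆₀-compatible = record
    { at-G₁ = λ k → ≡-by-expansion {+ k}
        (shiftAt 1 (ratioAt-κ₆₀ refl))
        (shiftAt 1 (ratioAt-γ₆₀ refl) ⟨-⟩ shiftAt 1 (ratioAt-a[,0] refl) ⟨+⟩ ratioAt-const 1728) tt
    ; at-G₀ = λ where
        zero    → subst₂ (λ u v → - b[ 1 ,0] ≡ u * v) (sym rational-unfold) (sym rational-unfold) refl
        (suc k) → ≡-by-expansion {+ k}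
          (⟨-⟩ shiftAt 2 (ratioAt-b[,0] refl))
          (shiftAt 2 (ratioAt-κ₆₀ refl) ⟨*⟩ shiftAt 1 (ratioAt-γ₆₀ refl)) tt
    }

  combination-by-value : ∀ {f g l h v} → l ≡ v → (∀ i → f i ≡ g i + v * h i) → Combination f g l h
  combination-by-value refl f≡ = combination f≡

  A₂-via-A₆ : ∀ k → Connected (λ k → γ₂₆ (suc k)) (λ k → coeff A[ suc k ,2]) (λ k → coeff A[ k ,6]) k
  A₂-via-A₆ = connected A₂-recurrence A₆-recurrence γ₂₆-compatible
    (combination-by-value rational-unfold λ { 0 → refl ; 1 → refl ; (suc (suc i)) → refl })
    (combination-by-value rational-unfold λ { 0 → refl ; 1 → refl ; 2 → refl ; (suc (suc (suc i))) → refl })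

  A₂-via-A₈ : ∀ k → Connected (λ k → γ₂₈ (suc k)) (λ k → coeff A[ suc k ,2]) (λ k → coeff A[ k ,8]) k
  A₂-via-A₈ = connected A₂-recurrence A₈-recurrence γ₂₈-compatible
    (combination-by-value rational-unfold λ { 0 → refl ; 1 → refl ; (suc (suc i)) → refl })
    (combination-by-value rational-unfold λ { 0 → refl ; 1 → refl ; 2 → refl ; (suc (suc (suc i))) → refl })

  A₆-via-A₀ : ∀ k → Connected γ₆₀ (λ k → coeff A[ k ,6]) (λ k → coeff A[ k ,0]) k
  A₆-via-A₀ = connected A₆-recurrence A₀-recurrence γ₆₀-compatible
    (combination-by-value rational-unfold λ { 0 → refl ; (suc i) → refl })
    (combination-by-value rational-unfold λ { 0 → refl ; 1 → refl ; (suc (suc i)) → refl })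

  A₈-via-A₀ : ∀ k → Connected γ₈₀ (λ k → coeff A[ k ,8]) (λ k → coeff A[ k ,0]) k
  A₈-via-A₀ = connected A₈-recurrence A₀-recurrence γ₈₀-compatible
    (combination-by-value rational-unfold λ { 0 → refl ; (suc i) → refl })
    (combination-by-value rational-unfold λ { 0 → refl ; 1 → refl ; (suc (suc i)) → refl })

  A₂-via-XA₆ : ∀ k → Combination (coeff A[ 2 ℕ.+ k ,2]) (mulX- 0ℚ (coeff A[ 1 ℕ.+ k ,6])) (κ₂₆ (1 ℕ.+ k)) (coeff A[ 1 ℕ.+ k ,2])
  A₂-via-XA₆ = x-connected A₂-via-A₆ A₆-recurrence κ₂₆-compatible

  A₂-via-X₁₇₂₈A₈ : ∀ k → Combination (coeff A[ 2 ℕ.+ k ,2]) (mulX- (c 1728) (coeff A[ 1 ℕ.+ k ,8])) (κ₂₈ (1 ℕ.+ k)) (coeff A[ 1 ℕ.+ k ,2])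
  A₂-via-X₁₇₂₈A₈ = x-connected A₂-via-A₈ A₈-recurrence κ₂₈-compatible

  A₈-via-XA₀ : ∀ k → Combination (coeff A[ 1 ℕ.+ k ,8]) (mulX- 0ℚ (coeff A[ 1 ℕ.+ k ,0])) (κ₈₀ (1 ℕ.+ k)) (coeff A[ k ,8])
  A₈-via-XA₀ = x-connected A₈-via-A₀ A₀-recurrence κ₈₀-compatible

  A₆-via-X₁₇₂₈A₀ : ∀ k → Combination (coeff A[ 1 ℕ.+ k ,6]) (mulX- (c 1728) (coeff A[ 1 ℕ.+ k ,0])) (κ₆₀ (1 ℕ.+ k)) (coeff A[ k ,6])
  A₆-via-X₁₇₂₈A₀ = x-connected A₆-via-A₀ A₀-recurrence κ₆₀-compatible

  IntegralAndCongruent : ℕ → Poly → Poly → Poly → Poly → Set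
  IntegralAndCongruent p P₁ P₂ P₃ P₄ =
    (PIntegralPoly p P₁ × PIntegralPoly p P₂ × PIntegralPoly p P₃ × PIntegralPoly p P₄)
    × (P₁ ≡ P₂ [modₚ p ]) × (P₁ ≡ P₃ [modₚ p ]) × (P₁ ≡ P₄ [modₚ p ])
    × (P₂ ≡ P₃ [modₚ p ]) × (P₂ ≡ P₄ [modₚ p ]) × (P₃ ≡ P₄ [modₚ p ])

  record _hasCoefficients_ (P : Poly) (F : ℕ → ℚ) : Set where
    constructor coefficients
    field coeff≡ : ∀ i → coeff P i ≡ F i
  open _hasCoefficients_

  own-coefficients : ∀ P → P hasCoefficients coeff P
  own-coefficients P = coefficients λ _ → refl

  X⁰⊛-coefficients : ∀ Q → ((X ^ₚ 0) ⊛ Q) hasCoefficients coeff Q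
  X⁰⊛-coefficients Q = coefficients λ i → trans (coeff-C⊛ 1ℚ Q i) (ℚ.*-identityˡ _)

  X¹⊛-coefficients : ∀ Q → ((X ^ₚ 1) ⊛ Q) hasCoefficients mulX- 0ℚ (coeff Q)
  X¹⊛-coefficients Q = coefficients (coeff-X-⊛ 0ℚ Q)

  Y¹⊛-coefficients : ∀ Q → ((X- (c 1728) ^ₚ 1) ⊛ Q) hasCoefficients mulX- (c 1728) (coeff Q)
  Y¹⊛-coefficients Q = coefficients (coeff-X-⊛ (c 1728) Q)

  X⁰Y⁰⊛-coefficients : ∀ Q → ((X ^ₚ 0) ⊛ (X- (c 1728) ^ₚ 0) ⊛ Q) hasCoefficients coeff Q
  X⁰Y⁰⊛-coefficients Q = coefficients (coeff≡ (X⁰⊛-coefficients Q))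

  X¹Y⁰⊛-coefficients : ∀ Q → ((X ^ₚ 1) ⊛ (X- (c 1728) ^ₚ 0) ⊛ Q) hasCoefficients mulX- 0ℚ (coeff Q)
  X¹Y⁰⊛-coefficients Q = coefficients (coeff-X-⊛ 0ℚ Q)

  X⁰Y¹⊛-coefficients : ∀ Q → ((X ^ₚ 0) ⊛ (X- (c 1728) ^ₚ 1) ⊛ Q) hasCoefficients mulX- (c 1728) (coeff Q)
  X⁰Y¹⊛-coefficients Q = coefficients (coeff-X-⊛ (c 1728) Q)

  X¹Y¹⊛-coefficients : ∀ Q → ((X ^ₚ 1) ⊛ (X- (c 1728) ^ₚ 1) ⊛ Q) hasCoefficients mulX- 0ℚ (mulX- (c 1728) (coeff Q))
  X¹Y¹⊛-coefficients Q = coefficients coeff-X¹Y¹⊛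
    where
    zeros : ∀ x y → 0ℚ * x + 0ℚ ≡ 0ℚ - 0ℚ * y
    zeros = RingSolver.solve-∀ ℚ-ring
    drop : ∀ x y z → 0ℚ * x + y ≡ y - 0ℚ * z
    drop = RingSolver.solve-∀ ℚ-ring
    coeff-X¹Y¹⊛ : ∀ i → coeff ((X ^ₚ 1) ⊛ (X- (c 1728) ^ₚ 1) ⊛ Q) i ≡ mulX- 0ℚ (mulX- (c 1728) (coeff Q)) i
    coeff-X¹Y¹⊛ zero    = trans (coeff-∷⊛ 0ℚ (X- (c 1728)) Q 0) (zeros (coeff Q 0) (mulX- (c 1728) (coeff Q) 0))
    coeff-X¹Y¹⊛ (suc i) = trans (coeff-∷⊛ 0ℚ (X- (c 1728)) Q (suc i))
      (trans (cong (_+_ (0ℚ * coeff Q (suc i))) (coeff-X-⊛ (c 1728) Q i)) (drop (coeff Q (suc i)) (mulX- (c 1728) (coeff Q) i) (mulX- (c 1728) (coeff Q) (suc i))))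

  module Modulo (p : ℕ) (p-prime : Prime p) where

    p∤1 : ¬ p ∣ 1
    p∤1 p∣1 with ℕ∣.∣1⇒≡1 p∣1 | prime⇒nonTrivial p-prime
    ... | refl | ()

    p∤* : ∀ {i j} → ¬ p ∣ ℤ.∣ i ∣ → ¬ p ∣ ℤ.∣ j ∣ → ¬ p ∣ ℤ.∣ i ℤ.* j ∣
    p∤* {i} {j} p∤i p∤j p∣ij with euclidsLemma ℤ.∣ i ∣ ℤ.∣ j ∣ p-prime (subst (p ∣_) (ℤ.abs-* i j) p∣ij)
    ... | inj₁ p∣i = p∤i p∣i
    ... | inj₂ p∣j = p∤j p∣j

    private
      numerator-cross : ∀ {x n d} → IsRatio x n d → ℤ.∣ ↥ x ∣ ℕ.* ℤ.∣ d ∣ ≡ ℤ.∣ n ∣ ℕ.* ↧ₙ x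
      numerator-cross {x} {n} {d} r = begin
        ℤ.∣ ↥ x ∣ ℕ.* ℤ.∣ d ∣  ≡⟨ ℤ.abs-* (↥ x) d ⟨
        ℤ.∣ ↥ x ℤ.* d ∣        ≡⟨ cong ℤ.∣_∣ (ratio-proportional (ratio-canonical x) r) ⟩
        ℤ.∣ n ℤ.* ↧ x ∣        ≡⟨ ℤ.abs-* n (↧ x) ⟩
        ℤ.∣ n ∣ ℕ.* ↧ₙ x       ∎
        where open ≡-Reasoning

    PIntegral-ratio : ∀ {x n d} → IsRatio x n d → ¬ p ∣ ℤ.∣ d ∣ → PIntegral p x
    PIntegral-ratio {x@(ℚ.mkℚ _ _ coprime)} {n} {d} r p∤d p∣↧x = p∤d (ℕ∣.∣-trans p∣↧x ↧x∣d)
      where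
      ↧x∣d : ↧ₙ x ∣ ℤ.∣ d ∣
      ↧x∣d = Coprime.coprime-divisor (Coprime.sym (Coprime.recompute coprime)) (divides ℤ.∣ n ∣ (numerator-cross r))

    InPZp-ratio : ∀ {x n d} → IsRatio x n d → p ∣ ℤ.∣ n ∣ → ¬ p ∣ ℤ.∣ d ∣ → InPZp p x
    InPZp-ratio {x} {n} {d} r p∣n p∤d = PIntegral-ratio r p∤d , p∣↥x
      where
      p∣↥x : p ∣ ℤ.∣ ↥ x ∣
      p∣↥x with euclidsLemma ℤ.∣ ↥ x ∣ ℤ.∣ d ∣ p-prime (subst (p ∣_) (sym (numerator-cross r)) (ℕ∣.∣m⇒∣m*n (↧ₙ x) p∣n))
      ... | inj₁ p∣↥x = p∣↥x
      ... | inj₂ p∣d  = ⊥-elim (p∤d p∣d)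

    PIntegral-+ : ∀ {x y} → PIntegral p x → PIntegral p y → PIntegral p (x + y)
    PIntegral-+ {x} {y} x-int y-int = PIntegral-ratio (ratio-+ (ratio-canonical x) (ratio-canonical y)) (p∤* {↧ x} {↧ y} x-int y-int)

    PIntegral-* : ∀ {x y} → PIntegral p x → PIntegral p y → PIntegral p (x * y)
    PIntegral-* {x} {y} x-int y-int = PIntegral-ratio (ratio-* (ratio-canonical x) (ratio-canonical y)) (p∤* {↧ x} {↧ y} x-int y-int)

    PIntegral-neg : ∀ {x} → PIntegral p x → PIntegral p (- x)
    PIntegral-neg {x} x-int = PIntegral-ratio (ratio-neg (ratio-canonical x)) x-int

    PIntegral-- : ∀ {x y} → PIntegral p x → PIntegral p y → PIntegral p (x - y)
    PIntegral-- {x} {y} x-int y-int = PIntegral-+ {x} { - y} x-int (PIntegral-neg {y} y-int)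

    private
      signed : ∀ {i} → p ∣ ℤ.∣ i ∣ → + p ℤ∣.∣ i
      signed = ℤ∣.∣ᵤ⇒∣
      unsigned : ∀ {i} → + p ℤ∣.∣ i → p ∣ ℤ.∣ i ∣
      unsigned = ℤ∣.∣⇒∣ᵤ

    InPZp-+ : ∀ {x y} → InPZp p x → InPZp p y → InPZp p (x + y)
    InPZp-+ {x} {y} (x-int , p∣x) (y-int , p∣y) = InPZp-ratio (ratio-+ (ratio-canonical x) (ratio-canonical y))
      (unsigned {↥ x ℤ.* ↧ y ℤ.+ ↥ y ℤ.* ↧ x} (ℤ∣.∣m∣n⇒∣m+n (ℤ∣.∣m⇒∣m*n (↧ y) (signed {↥ x} p∣x)) (ℤ∣.∣m⇒∣m*n (↧ x) (signed {↥ y} p∣y))))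
      (p∤* {↧ x} {↧ y} x-int y-int)

    InPZp-neg : ∀ {x} → InPZp p x → InPZp p (- x)
    InPZp-neg {x} (x-int , p∣x) = InPZp-ratio (ratio-neg (ratio-canonical x)) (unsigned {ℤ.- ↥ x} (ℤ∣.∣m⇒∣-m (signed {↥ x} p∣x))) x-int

    InPZp-* : ∀ {x y} → InPZp p x → PIntegral p y → InPZp p (x * y)
    InPZp-* {x} {y} (x-int , p∣x) y-int = InPZp-ratio (ratio-* (ratio-canonical x) (ratio-canonical y))
      (unsigned {↥ x ℤ.* ↥ y} (ℤ∣.∣m⇒∣m*n (↥ y) (signed {↥ x} p∣x))) (p∤* {↧ x} {↧ y} x-int y-int)

    InPZp-fromℤ : ∀ {i} → p ∣ ℤ.∣ i ∣ → InPZp p (fromℤ i)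
    InPZp-fromℤ p∣i = p∤1 , p∣i

    PIntegral-ratioAt : ∀ {z x N D} → IsRatioAt z x N D → ¬ p ∣ ℤ.∣ ⟦ D ⟧ z ∣ → PIntegral p x
    PIntegral-ratioAt r = PIntegral-ratio (ratioAt r)

    InPZp-ratioAt : ∀ {z x s F G D} → IsRatioAt z x (K s :* F :* G) D → p ∣ ℤ.∣ ⟦ F ⟧ z ∣ ⊎ p ∣ ℤ.∣ ⟦ G ⟧ z ∣ → ¬ p ∣ ℤ.∣ ⟦ D ⟧ z ∣ → InPZp p x
    InPZp-ratioAt {z} {s = s} {F} {G} r p∣f⊎g p∤d = InPZp-ratio (ratioAt r) (subst (p ∣_) (sym ∣sfg∣) (divides-product p∣f⊎g)) p∤d
      where
      f g : ℤ
      f = ⟦ F ⟧ z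
      g = ⟦ G ⟧ z
      ∣sfg∣ : ℤ.∣ s ℤ.* f ℤ.* g ∣ ≡ ℤ.∣ s ∣ ℕ.* ℤ.∣ f ∣ ℕ.* ℤ.∣ g ∣
      ∣sfg∣ = trans (ℤ.abs-* (s ℤ.* f) g) (cong (ℕ._* ℤ.∣ g ∣) (ℤ.abs-* s f))
      divides-product : p ∣ ℤ.∣ f ∣ ⊎ p ∣ ℤ.∣ g ∣ → p ∣ ℤ.∣ s ∣ ℕ.* ℤ.∣ f ∣ ℕ.* ℤ.∣ g ∣
      divides-product (inj₁ p∣f) = ℕ∣.∣m⇒∣m*n ℤ.∣ g ∣ (ℕ∣.∣n⇒∣m*n ℤ.∣ s ∣ p∣f)
      divides-product (inj₂ p∣g) = ℕ∣.∣n⇒∣m*n (ℤ.∣ s ∣ ℕ.* ℤ.∣ f ∣) p∣g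

    record Integral (f : ℕ → ℚ) : Set where
      constructor integral
      field integral-at : ∀ i → PIntegral p (f i)
    open Integral

    infix 4 _≈ₚ_
    record _≈ₚ_ (f g : ℕ → ℚ) : Set where
      constructor congruent
      field congruent-at : ∀ i → InPZp p (f i - g i)
    open _≈ₚ_

    Integral-mulX- : ∀ {a f} → PIntegral p a → Integral f → Integral (mulX- a f)
    Integral-mulX- {a} {f} a-int (integral f-int) = integral λ i →
      PIntegral-- {shift f i} {a * f i} (shift-int i) (PIntegral-* {a} {f i} a-int (f-int i))
      where
      shift-int : ∀ i → PIntegral p (shift f i)
      shift-int zero    = p∤1
      shift-int (suc i) = f-int i

    ≈ₚ-sym : ∀ {f g} → f ≈ₚ g → g ≈ₚ f
    ≈ₚ-sym {f} {g} (congruent f≈g) = congruent λ i → subst (InPZp p) (flip (f i) (g i)) (InPZp-neg {f i - g i} (f≈g i))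
      where
      flip : ∀ x y → - (x - y) ≡ y - x
      flip = RingSolver.solve-∀ ℚ-ring

    ≈ₚ-trans : ∀ {f g h} → f ≈ₚ g → g ≈ₚ h → f ≈ₚ h
    ≈ₚ-trans {f} {g} {h} (congruent f≈g) (congruent g≈h) = congruent λ i →
      subst (InPZp p) (telescope (f i) (g i) (h i)) (InPZp-+ {f i - g i} {g i - h i} (f≈g i) (g≈h i))
      where
      telescope : ∀ x y z → (x - y) + (y - z) ≡ x - z
      telescope = RingSolver.solve-∀ ℚ-ring

    ≈ₚ-mulX- : ∀ {a f g} → PIntegral p a → f ≈ₚ g → mulX- a f ≈ₚ mulX- a g
    ≈ₚ-mulX- {a} {f} {g} a-int (congruent f≈g) = congruent λ i → subst (InPZp p) (regroup (shift f i) (shift g i) a (f i) (g i))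
      (InPZp-+ {shift f i - shift g i} { - ((f i - g i) * a)} (shift-≈ i) (InPZp-neg {(f i - g i) * a} (InPZp-* {f i - g i} {a} (f≈g i) a-int)))
      where
      shift-≈ : ∀ i → InPZp p (shift f i - shift g i)
      shift-≈ zero    = InPZp-fromℤ {0ℤ} (p ℕ∣.∣0)
      shift-≈ (suc i) = f≈g i
      regroup : ∀ s t a x y → s - t + - ((x - y) * a) ≡ (s - a * x) - (t - a * y)
      regroup = RingSolver.solve-∀ ℚ-ring

    ≈ₚ-by : ∀ {f g l h} → Combination f g l h → InPZp p l → Integral h → f ≈ₚ g
    ≈ₚ-by {f} {g} {l} {h} f≡ l∈pℤₚ (integral h-int) = congruent λ i →
      subst (InPZp p) (sym (difference (at f≡ i))) (InPZp-* {l} {h i} l∈pℤₚ (h-int i))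
      where
      difference : ∀ {i x} → x ≡ g i + l * h i → x - g i ≡ l * h i
      difference {i} refl = cancel (g i) l (h i)
        where
        cancel : ∀ y l z → y + l * z - y ≡ l * z
        cancel = RingSolver.solve-∀ ℚ-ring

    integral-by-recurrence : ∀ {a b f} → ThreeTerm a b f → Integral (f 0) → Integral (f 1) →
      ∀ n → (∀ j → suc j < n → PIntegral p (a (suc j)) × PIntegral p (b (suc j))) → Integral (f n)
    integral-by-recurrence {a} {b} {f} rec f₀ f₁ zero    cs = f₀
    integral-by-recurrence {a} {b} {f} rec f₀ f₁ (suc n) cs = proj₂ (pair n ℕ.≤-refl)
      where
      pair : ∀ k → suc k ≤ suc n → Integral (f k) × Integral (f (suc k))
      pair zero    _       = f₀ , f₁
      pair (suc k) 2+k≤1+n with pair k (ℕ.<⇒≤ 2+k≤1+n)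
      ... | fₖ , fₖ₊₁ = fₖ₊₁ , integral λ i → subst (PIntegral p) (sym (recurrence rec k i))
        (PIntegral-- {mulX- (a (1 ℕ.+ k)) (f (1 ℕ.+ k)) i} {b (1 ℕ.+ k) * f k i}
          (integral-at (Integral-mulX- {a (1 ℕ.+ k)} (proj₁ (cs k 2+k≤1+n)) fₖ₊₁) i)
          (PIntegral-* {b (1 ℕ.+ k)} {f k i} (proj₂ (cs k 2+k≤1+n)) (integral-at fₖ i)))

    -- Below index N every denominator met is a product of n, n ± 1 and 2n ± 1, all prime to p.
    module Bounded (N : ℕ) (2N+1<p : 2 ℕ.* N ℕ.+ 1 < p) where
      private
        p∤-small : ∀ m .{{_ : ℕ.NonZero m}} → m ≤ 2 ℕ.* N ℕ.+ 1 → ¬ p ∣ m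
        p∤-small m m≤ = ℕ∣.>⇒∤ (ℕ.≤-<-trans m≤ 2N+1<p)

        2n+1≤ : ∀ {n} → n ≤ N → 2 ℕ.* n ℕ.+ 1 ≤ 2 ℕ.* N ℕ.+ 1
        2n+1≤ n≤N = ℕ.+-monoˡ-≤ 1 (ℕ.*-monoʳ-≤ 2 n≤N)

      module _ {k} (1+k≤N : suc k ≤ N) where
        p∤w : ¬ p ∣ ℤ.∣ + suc k ∣
        p∤w = p∤-small (suc k) (ℕ.≤-trans (ℕ.≤-trans (ℕ.m≤m+n (suc k) _) (ℕ.m≤m+n _ 1)) (2n+1≤ 1+k≤N))

        p∤w+1 : ¬ p ∣ ℤ.∣ + suc k ℤ.+ 1ℤ ∣
        p∤w+1 = p∤-small (suc k ℕ.+ 1) (ℕ.≤-trans (ℕ.+-monoˡ-≤ 1 (ℕ.m≤m+n (suc k) _)) (2n+1≤ 1+k≤N))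

        p∤2w+1 : ¬ p ∣ ℤ.∣ + 2 ℤ.* + suc k ℤ.+ 1ℤ ∣
        p∤2w+1 = p∤-small (2 ℕ.* suc k ℕ.+ 1) (2n+1≤ 1+k≤N)

        p∤2w-1 : ¬ p ∣ ℤ.∣ + 2 ℤ.* + suc k ℤ.- 1ℤ ∣
        p∤2w-1 = p∤-small (k ℕ.+ suc (k ℕ.+ 0)) {{ℕ.≢-nonZero (ℕ.m+1+n≢0 k)}} (ℕ.≤-trans (ℕ.≤-trans (ℕ.n≤1+n _) (ℕ.m≤m+n _ 1)) (2n+1≤ 1+k≤N))

        private
          w : ℤ
          w = + suc k

          p∤w[2w+1] : ¬ p ∣ ℤ.∣ w ℤ.* (+ 2 ℤ.* w ℤ.+ 1ℤ) ∣
          p∤w[2w+1] = p∤* {w} {+ 2 ℤ.* w ℤ.+ 1ℤ} p∤w p∤2w+1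

          p∤w[2w-1] : ¬ p ∣ ℤ.∣ w ℤ.* (+ 2 ℤ.* w ℤ.- 1ℤ) ∣
          p∤w[2w-1] = p∤* {w} {+ 2 ℤ.* w ℤ.- 1ℤ} p∤w p∤2w-1

          p∤w[w+1] : ¬ p ∣ ℤ.∣ w ℤ.* (w ℤ.+ 1ℤ) ∣
          p∤w[w+1] = p∤* {w} {w ℤ.+ 1ℤ} p∤w p∤w+1

          p∤[2w+1][2w-1] : ¬ p ∣ ℤ.∣ (+ 2 ℤ.* w ℤ.+ 1ℤ) ℤ.* (+ 2 ℤ.* w ℤ.- 1ℤ) ∣
          p∤[2w+1][2w-1] = p∤* {+ 2 ℤ.* w ℤ.+ 1ℤ} {+ 2 ℤ.* w ℤ.- 1ℤ} p∤2w+1 p∤2w-1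

          p∤w²[2w+1][2w-1] : ¬ p ∣ ℤ.∣ w ℤ.* w ℤ.* (+ 2 ℤ.* w ℤ.+ 1ℤ) ℤ.* (+ 2 ℤ.* w ℤ.- 1ℤ) ∣
          p∤w²[2w+1][2w-1] = p∤* {w ℤ.* w ℤ.* (+ 2 ℤ.* w ℤ.+ 1ℤ)} {+ 2 ℤ.* w ℤ.- 1ℤ}
            (p∤* {w ℤ.* w} {+ 2 ℤ.* w ℤ.+ 1ℤ} (p∤* {w} {w} p∤w p∤w) p∤2w+1) p∤2w-1

        a[,0]-integral : PIntegral p a[ suc k ,0]
        a[,0]-integral = PIntegral-ratioAt (ratioAt-a[,0] {k = k} refl) p∤[2w+1][2w-1]

        a[,2]-integral : PIntegral p a[ suc k ,2]
        a[,2]-integral = PIntegral-ratioAt (ratioAt-a[,2] {k = k} refl) p∤[2w+1][2w-1]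

        a[,6]-integral : PIntegral p a[ suc k ,6]
        a[,6]-integral = PIntegral-ratioAt (ratioAt-a[,6] {k = k} refl) p∤w[w+1]

        a[,8]-integral : PIntegral p a[ suc k ,8]
        a[,8]-integral = PIntegral-ratioAt (ratioAt-a[,8] {k = k} refl) p∤w[w+1]

        b[,6]-integral : PIntegral p b[ suc k ,6]
        b[,6]-integral = PIntegral-ratioAt (ratioAt-b[,6] {k = k} refl) p∤w²[2w+1][2w-1]

        b[,8]-integral : PIntegral p b[ suc k ,8]
        b[,8]-integral = PIntegral-ratioAt (ratioAt-b[,8] {k = k} refl) p∤w²[2w+1][2w-1]

        γ₂₆-vanishes : p ∣ ℤ.∣ + 12 ℤ.* w ℤ.+ 1ℤ ∣ ⊎ p ∣ ℤ.∣ + 12 ℤ.* w ℤ.- + 5 ∣ → InPZp p (γ₂₆ (suc k))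
        γ₂₆-vanishes p∣ = InPZp-ratioAt (ratioAt-γ₂₆ {k = k} refl) p∣ p∤w[2w-1]

        γ₂₈-vanishes : p ∣ ℤ.∣ + 12 ℤ.* w ℤ.+ 1ℤ ∣ ⊎ p ∣ ℤ.∣ + 12 ℤ.* w ℤ.- + 7 ∣ → InPZp p (γ₂₈ (suc k))
        γ₂₈-vanishes p∣ = InPZp-ratioAt (ratioAt-γ₂₈ {k = k} refl) p∣ p∤w[2w-1]

        γ₆₀-vanishes : p ∣ ℤ.∣ + 12 ℤ.* w ℤ.+ 1ℤ ∣ ⊎ p ∣ ℤ.∣ + 12 ℤ.* w ℤ.+ + 5 ∣ → InPZp p (γ₆₀ (suc k))
        γ₆₀-vanishes p∣ = InPZp-ratioAt (ratioAt-γ₆₀ {k = k} refl) p∣ p∤w[2w+1]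

        κ₂₆-vanishes : p ∣ ℤ.∣ + 12 ℤ.* w ℤ.- 1ℤ ∣ ⊎ p ∣ ℤ.∣ + 12 ℤ.* w ℤ.+ + 5 ∣ → InPZp p (κ₂₆ (suc k))
        κ₂₆-vanishes p∣ = InPZp-ratioAt (ratioAt-κ₂₆ {k = k} refl) p∣ p∤w[2w+1]

        κ₂₈-vanishes : p ∣ ℤ.∣ + 12 ℤ.* w ℤ.- 1ℤ ∣ ⊎ p ∣ ℤ.∣ + 12 ℤ.* w ℤ.+ + 7 ∣ → InPZp p (κ₂₈ (suc k))
        κ₂₈-vanishes p∣ = InPZp-ratioAt (ratioAt-κ₂₈ {k = k} refl) p∣ p∤w[2w+1]

        κ₈₀-vanishes : p ∣ ℤ.∣ + 12 ℤ.* w ℤ.- + 7 ∣ ⊎ p ∣ ℤ.∣ + 12 ℤ.* w ℤ.- 1ℤ ∣ → InPZp p (κ₈₀ (suc k))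
        κ₈₀-vanishes p∣ = InPZp-ratioAt (ratioAt-κ₈₀ {k = k} refl) p∣ p∤w[2w-1]

        κ₆₀-vanishes : p ∣ ℤ.∣ + 12 ℤ.* w ℤ.- + 5 ∣ ⊎ p ∣ ℤ.∣ + 12 ℤ.* w ℤ.- 1ℤ ∣ → InPZp p (κ₆₀ (suc k))
        κ₆₀-vanishes p∣ = InPZp-ratioAt (ratioAt-κ₆₀ {k = k} refl) p∣ p∤w[2w-1]

      module _ {k} (2+k≤N : suc (suc k) ≤ N) where
        private
          w : ℤ
          w = + suc (suc k)

          p∤w[w-1][2w-1]² : ¬ p ∣ ℤ.∣ w ℤ.* (w ℤ.- 1ℤ) ℤ.* (+ 2 ℤ.* w ℤ.- 1ℤ) ℤ.* (+ 2 ℤ.* w ℤ.- 1ℤ) ∣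
          p∤w[w-1][2w-1]² = p∤* {w ℤ.* (w ℤ.- 1ℤ) ℤ.* (+ 2 ℤ.* w ℤ.- 1ℤ)} {+ 2 ℤ.* w ℤ.- 1ℤ}
            (p∤* {w ℤ.* (w ℤ.- 1ℤ)} {+ 2 ℤ.* w ℤ.- 1ℤ}
              (p∤* {w} {w ℤ.- 1ℤ} (p∤w 2+k≤N) (p∤w (ℕ.≤-trans (ℕ.n≤1+n _) 2+k≤N))) (p∤2w-1 2+k≤N))
            (p∤2w-1 2+k≤N)

        b[,0]-integral : PIntegral p b[ suc (suc k) ,0]
        b[,0]-integral = PIntegral-ratioAt (ratioAt-b[,0] {k = k} refl) p∤w[w-1][2w-1]²

        b[,2]-integral : PIntegral p b[ suc (suc k) ,2]
        b[,2]-integral = PIntegral-ratioAt (ratioAt-b[,2] {k = k} refl) p∤w[w-1][2w-1]²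

      private
        index≤N : ∀ {j n} → suc j < n → n ≤ suc N → suc j ≤ N
        index≤N j<n n≤1+N = ℕ.≤-pred (ℕ.≤-trans j<n n≤1+N)

      A₀-integral : ∀ n → n ≤ suc N → Integral (coeff A[ n ,0])
      A₀-integral n n≤1+N = integral-by-recurrence A₀-recurrence (integral λ _ → p∤1) (integral λ { 0 → p∤1 ; (suc i) → p∤1 }) n
        (λ j j<n → a[,0]-integral (index≤N j<n n≤1+N) , b-integral j (index≤N j<n n≤1+N))
        where
        b-integral : ∀ j → suc j ≤ N → PIntegral p b[ suc j ,0]
        b-integral zero    _     = p∤1
        b-integral (suc j) 2+j≤N = b[,0]-integral 2+j≤N

      A₂-integral : ∀ n → n ≤ suc N → Integral (coeff A[ n ,2])
      A₂-integral zero    _     = integral λ { 0 → p∤1 ; (suc i) → p∤1 }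
      A₂-integral (suc n) n≤1+N = integral-by-recurrence A₂-recurrence
        (integral λ { 0 → p∤1 ; 1 → p∤1 ; (suc (suc i)) → p∤1 }) (integral λ { 0 → p∤1 ; 1 → p∤1 ; 2 → p∤1 ; (suc (suc (suc i))) → p∤1 }) n
        (λ j j<n → a[,2]-integral (2+j≤N j<n) , b[,2]-integral (2+j≤N j<n))
        where
        2+j≤N : ∀ {j} → suc j < n → suc (suc j) ≤ N
        2+j≤N j<n = ℕ.≤-trans j<n (ℕ.≤-pred n≤1+N)

      A₆-integral : ∀ n → n ≤ suc N → Integral (coeff A[ n ,6])
      A₆-integral n n≤1+N = integral-by-recurrence A₆-recurrence
        (integral λ { 0 → p∤1 ; (suc i) → p∤1 }) (integral λ { 0 → p∤1 ; 1 → p∤1 ; (suc (suc i)) → p∤1 }) n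
        (λ j j<n → a[,6]-integral (index≤N j<n n≤1+N) , b[,6]-integral (index≤N j<n n≤1+N))

      A₈-integral : ∀ n → n ≤ suc N → Integral (coeff A[ n ,8])
      A₈-integral n n≤1+N = integral-by-recurrence A₈-recurrence
        (integral λ { 0 → p∤1 ; (suc i) → p∤1 }) (integral λ { 0 → p∤1 ; 1 → p∤1 ; (suc (suc i)) → p∤1 }) n
        (λ j j<n → a[,8]-integral (index≤N j<n n≤1+N) , b[,8]-integral (index≤N j<n n≤1+N))

    conclusion : ∀ {P₁ P₂ P₃ P₄ F₁ F₂ F₃ F₄} →
      P₁ hasCoefficients F₁ → P₂ hasCoefficients F₂ → P₃ hasCoefficients F₃ → P₄ hasCoefficients F₄ →
      Integral F₁ → Integral F₂ → Integral F₃ → Integral F₄ →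
      F₁ ≈ₚ F₂ → F₁ ≈ₚ F₃ → F₁ ≈ₚ F₄ → IntegralAndCongruent p P₁ P₂ P₃ P₄
    conclusion e₁ e₂ e₃ e₄ F₁-int F₂-int F₃-int F₄-int F₁≈F₂ F₁≈F₃ F₁≈F₄ =
      (poly e₁ F₁-int , poly e₂ F₂-int , poly e₃ F₃-int , poly e₄ F₄-int) ,
      mod e₁ e₂ F₁≈F₂ , mod e₁ e₃ F₁≈F₃ , mod e₁ e₄ F₁≈F₄ ,
      mod e₂ e₃ (≈ₚ-trans (≈ₚ-sym F₁≈F₂) F₁≈F₃) , mod e₂ e₄ (≈ₚ-trans (≈ₚ-sym F₁≈F₂) F₁≈F₄) , mod e₃ e₄ (≈ₚ-trans (≈ₚ-sym F₁≈F₃) F₁≈F₄)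
      where
      poly : ∀ {P F} → P hasCoefficients F → Integral F → PIntegralPoly p P
      poly e F-int i = subst (PIntegral p) (sym (coeff≡ e i)) (integral-at F-int i)
      mod : ∀ {P Q F G} → P hasCoefficients F → Q hasCoefficients G → F ≈ₚ G → P ≡ Q [modₚ p ]
      mod e e′ F≈G i = subst (InPZp p) (sym (cong₂ _-_ (coeff≡ e i) (coeff≡ e′ i))) (congruent-at F≈G i)

    p∣12w+r : ∀ {k r} → p ≡ 12 ℕ.* suc k ℕ.+ r → p ∣ ℤ.∣ + 12 ℤ.* + suc k ℤ.+ + r ∣
    p∣12w+r = ℕ∣.∣-reflexive

    p∣12w-r : ∀ {k r} → 12 ℕ.* suc k ≡ p ℕ.+ r → p ∣ ℤ.∣ + 12 ℤ.* + suc k ℤ.- + r ∣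
    p∣12w-r {k} {r} 12w≡p+r = ℕ∣.∣-reflexive (sym (cong ℤ.∣_∣ (trans (cong (λ t → + t ℤ.- + r) 12w≡p+r) (cancel (+ p) (+ r)))))
      where
      cancel : ∀ a b → a ℤ.+ b ℤ.- b ≡ a
      cancel = solve-∀

    <-by-excess : ∀ {a b} e → b ≡ suc a ℕ.+ e → a < b
    <-by-excess {a} e refl = ℕ.m≤m+n (suc a) e

    private
      ≤2+ : ∀ n → n ≤ suc (suc n)
      ≤2+ n = ℕ.≤-trans (ℕ.n≤1+n n) (ℕ.n≤1+n (suc n))

    caseA : ∀ n → p ≡ 12 ℕ.* suc n ℕ.+ 1 →
      IntegralAndCongruent p A[ suc n ,2] ((X ^ₚ 0) ⊛ A[ suc n ,6]) ((X- (c 1728) ^ₚ 0) ⊛ A[ suc n ,8])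
        ((X ^ₚ 0) ⊛ (X- (c 1728) ^ₚ 0) ⊛ A[ suc (suc n) ,0])
    caseA n p≡ = conclusion
      (own-coefficients A[ suc n ,2]) (X⁰⊛-coefficients A[ suc n ,6]) (X⁰⊛-coefficients A[ suc n ,8]) (X⁰Y⁰⊛-coefficients A[ suc (suc n) ,0])
      (A₂-integral (suc n) (ℕ.n≤1+n _)) (A₆-integral (suc n) (ℕ.n≤1+n _)) (A₈-integral (suc n) (ℕ.n≤1+n _)) (A₀-integral (suc (suc n)) ℕ.≤-refl)
      A₂≈A₆ A₂≈A₈ (≈ₚ-trans A₂≈A₆ A₆≈A₀)
      where
      excess : ∀ n → 12 ℕ.* suc n ℕ.+ 1 ≡ suc (2 ℕ.* suc n ℕ.+ 1) ℕ.+ (10 ℕ.* n ℕ.+ 9)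
      excess = ℕ-Solver.solve-∀
      open Bounded (suc n) (<-by-excess (10 ℕ.* n ℕ.+ 9) (trans p≡ (excess n)))
      p∣12w+1 : p ∣ ℤ.∣ + 12 ℤ.* + suc n ℤ.+ 1ℤ ∣
      p∣12w+1 = p∣12w+r {n} {1} p≡
      A₂≈A₆ : coeff A[ suc n ,2] ≈ₚ coeff A[ suc n ,6]
      A₂≈A₆ = ≈ₚ-by (A₂-via-A₆ n) (γ₂₆-vanishes ℕ.≤-refl (inj₁ p∣12w+1)) (A₆-integral n (≤2+ n))
      A₂≈A₈ : coeff A[ suc n ,2] ≈ₚ coeff A[ suc n ,8]
      A₂≈A₈ = ≈ₚ-by (A₂-via-A₈ n) (γ₂₈-vanishes ℕ.≤-refl (inj₁ p∣12w+1)) (A₈-integral n (≤2+ n))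
      A₆≈A₀ : coeff A[ suc n ,6] ≈ₚ coeff A[ suc (suc n) ,0]
      A₆≈A₀ = ≈ₚ-by (A₆-via-A₀ (suc n)) (γ₆₀-vanishes ℕ.≤-refl (inj₁ p∣12w+1)) (A₀-integral (suc n) (ℕ.n≤1+n _))

    -- For m = 0 the relation through κ₂₆ (resp. κ₂₈) is unavailable, as κ has a pole at 0,
    -- but the difference is the constant -720 = -144·5 (resp. 1008 = 144·7).
    A₂≈XA₆-when-5 : ∀ m → p ≡ 12 ℕ.* m ℕ.+ 5 → 2 ℕ.* suc m ℕ.+ 1 < p → coeff A[ suc m ,2] ≈ₚ mulX- 0ℚ (coeff A[ m ,6])
    A₂≈XA₆-when-5 zero    p≡5 _ = congruent λ where
      0             → InPZp-fromℤ {ℤ.- + 720} (subst (_∣ 720) (sym p≡5) (divides 144 refl))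
      1             → InPZp-fromℤ {0ℤ} (p ℕ∣.∣0)
      (suc (suc i)) → InPZp-fromℤ {0ℤ} (p ℕ∣.∣0)
    A₂≈XA₆-when-5 (suc m) p≡ bound = ≈ₚ-by (A₂-via-XA₆ m) (κ₂₆-vanishes (ℕ.n≤1+n _) (inj₂ (p∣12w+r {m} {5} p≡))) (A₂-integral (suc m) (≤2+ _))
      where open Bounded (suc (suc m)) bound

    A₂≈YA₈-when-7 : ∀ m → p ≡ 12 ℕ.* m ℕ.+ 7 → 2 ℕ.* suc m ℕ.+ 1 < p → coeff A[ suc m ,2] ≈ₚ mulX- (c 1728) (coeff A[ m ,8])
    A₂≈YA₈-when-7 zero    p≡7 _ = congruent λ where
      0             → InPZp-fromℤ {+ 1008} (subst (_∣ 1008) (sym p≡7) (divides 144 refl))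
      1             → InPZp-fromℤ {0ℤ} (p ℕ∣.∣0)
      (suc (suc i)) → InPZp-fromℤ {0ℤ} (p ℕ∣.∣0)
    A₂≈YA₈-when-7 (suc m) p≡ bound = ≈ₚ-by (A₂-via-X₁₇₂₈A₈ m) (κ₂₈-vanishes (ℕ.n≤1+n _) (inj₂ (p∣12w+r {m} {7} p≡))) (A₂-integral (suc m) (≤2+ _))
      where open Bounded (suc (suc m)) bound

    caseB : ∀ m → p ≡ 12 ℕ.* m ℕ.+ 5 →
      IntegralAndCongruent p A[ suc m ,2] ((X ^ₚ 1) ⊛ A[ m ,6]) ((X- (c 1728) ^ₚ 0) ⊛ A[ suc m ,8])
        ((X ^ₚ 1) ⊛ (X- (c 1728) ^ₚ 0) ⊛ A[ suc m ,0])
    caseB m p≡ = conclusion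
      (own-coefficients A[ suc m ,2]) (X¹⊛-coefficients A[ m ,6]) (X⁰⊛-coefficients A[ suc m ,8]) (X¹Y⁰⊛-coefficients A[ suc m ,0])
      (A₂-integral (suc m) (ℕ.n≤1+n _)) (Integral-mulX- {0ℚ} p∤1 (A₆-integral m (≤2+ m)))
      (A₈-integral (suc m) (ℕ.n≤1+n _)) (Integral-mulX- {0ℚ} p∤1 (A₀-integral (suc m) (ℕ.n≤1+n _)))
      (A₂≈XA₆-when-5 m p≡ bound) A₂≈A₈ (≈ₚ-trans A₂≈A₈ A₈≈XA₀)
      where
      excess : ∀ m → 12 ℕ.* m ℕ.+ 5 ≡ suc (2 ℕ.* suc m ℕ.+ 1) ℕ.+ (10 ℕ.* m ℕ.+ 1)
      excess = ℕ-Solver.solve-∀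
      bound : 2 ℕ.* suc m ℕ.+ 1 < p
      bound = <-by-excess (10 ℕ.* m ℕ.+ 1) (trans p≡ (excess m))
      open Bounded (suc m) bound
      p∣12w-7 : p ∣ ℤ.∣ + 12 ℤ.* + suc m ℤ.- + 7 ∣
      p∣12w-7 = p∣12w-r {m} {7} (trans (shifted m) (cong (ℕ._+ 7) (sym p≡)))
        where
        shifted : ∀ m → 12 ℕ.* suc m ≡ 12 ℕ.* m ℕ.+ 5 ℕ.+ 7
        shifted = ℕ-Solver.solve-∀
      A₂≈A₈ : coeff A[ suc m ,2] ≈ₚ coeff A[ suc m ,8]
      A₂≈A₈ = ≈ₚ-by (A₂-via-A₈ m) (γ₂₈-vanishes ℕ.≤-refl (inj₂ p∣12w-7)) (A₈-integral m (≤2+ m))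
      A₈≈XA₀ : coeff A[ suc m ,8] ≈ₚ mulX- 0ℚ (coeff A[ suc m ,0])
      A₈≈XA₀ = ≈ₚ-by (A₈-via-XA₀ m) (κ₈₀-vanishes ℕ.≤-refl (inj₁ p∣12w-7)) (A₈-integral m (≤2+ m))

    caseC : ∀ m → p ≡ 12 ℕ.* m ℕ.+ 7 →
      IntegralAndCongruent p A[ suc m ,2] ((X ^ₚ 0) ⊛ A[ suc m ,6]) ((X- (c 1728) ^ₚ 1) ⊛ A[ m ,8])
        ((X ^ₚ 0) ⊛ (X- (c 1728) ^ₚ 1) ⊛ A[ suc m ,0])
    caseC m p≡ = conclusion
      (own-coefficients A[ suc m ,2]) (X⁰⊛-coefficients A[ suc m ,6]) (Y¹⊛-coefficients A[ m ,8]) (X⁰Y¹⊛-coefficients A[ suc m ,0])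
      (A₂-integral (suc m) (ℕ.n≤1+n _)) (A₆-integral (suc m) (ℕ.n≤1+n _))
      (Integral-mulX- {c 1728} p∤1 (A₈-integral m (≤2+ m))) (Integral-mulX- {c 1728} p∤1 (A₀-integral (suc m) (ℕ.n≤1+n _)))
      A₂≈A₆ (A₂≈YA₈-when-7 m p≡ bound) (≈ₚ-trans A₂≈A₆ A₆≈YA₀)
      where
      excess : ∀ m → 12 ℕ.* m ℕ.+ 7 ≡ suc (2 ℕ.* suc m ℕ.+ 1) ℕ.+ (10 ℕ.* m ℕ.+ 3)
      excess = ℕ-Solver.solve-∀
      bound : 2 ℕ.* suc m ℕ.+ 1 < p
      bound = <-by-excess (10 ℕ.* m ℕ.+ 3) (trans p≡ (excess m))
      open Bounded (suc m) bound
      p∣12w-5 : p ∣ ℤ.∣ + 12 ℤ.* + suc m ℤ.- + 5 ∣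
      p∣12w-5 = p∣12w-r {m} {5} (trans (shifted m) (cong (ℕ._+ 5) (sym p≡)))
        where
        shifted : ∀ m → 12 ℕ.* suc m ≡ 12 ℕ.* m ℕ.+ 7 ℕ.+ 5
        shifted = ℕ-Solver.solve-∀
      A₂≈A₆ : coeff A[ suc m ,2] ≈ₚ coeff A[ suc m ,6]
      A₂≈A₆ = ≈ₚ-by (A₂-via-A₆ m) (γ₂₆-vanishes ℕ.≤-refl (inj₂ p∣12w-5)) (A₆-integral m (≤2+ m))
      A₆≈YA₀ : coeff A[ suc m ,6] ≈ₚ mulX- (c 1728) (coeff A[ suc m ,0])
      A₆≈YA₀ = ≈ₚ-by (A₆-via-X₁₇₂₈A₀ m) (κ₆₀-vanishes ℕ.≤-refl (inj₁ p∣12w-5)) (A₆-integral m (≤2+ m))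

    caseD : ∀ m → p ≡ 12 ℕ.* m ℕ.+ 11 →
      IntegralAndCongruent p A[ suc (suc m) ,2] ((X ^ₚ 1) ⊛ A[ suc m ,6]) ((X- (c 1728) ^ₚ 1) ⊛ A[ suc m ,8])
        ((X ^ₚ 1) ⊛ (X- (c 1728) ^ₚ 1) ⊛ A[ suc m ,0])
    caseD m p≡ = conclusion
      (own-coefficients A[ suc (suc m) ,2]) (X¹⊛-coefficients A[ suc m ,6]) (Y¹⊛-coefficients A[ suc m ,8]) (X¹Y¹⊛-coefficients A[ suc m ,0])
      (A₂-integral (suc (suc m)) ℕ.≤-refl) (Integral-mulX- {0ℚ} p∤1 (A₆-integral (suc m) (ℕ.n≤1+n _)))
      (Integral-mulX- {c 1728} p∤1 (A₈-integral (suc m) (ℕ.n≤1+n _)))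
      (Integral-mulX- {0ℚ} p∤1 (Integral-mulX- {c 1728} p∤1 (A₀-integral (suc m) (ℕ.n≤1+n _))))
      A₂≈XA₆ A₂≈YA₈ (≈ₚ-trans A₂≈XA₆ (≈ₚ-mulX- {0ℚ} p∤1 A₆≈YA₀))
      where
      excess : ∀ m → 12 ℕ.* m ℕ.+ 11 ≡ suc (2 ℕ.* suc m ℕ.+ 1) ℕ.+ (10 ℕ.* m ℕ.+ 7)
      excess = ℕ-Solver.solve-∀
      open Bounded (suc m) (<-by-excess (10 ℕ.* m ℕ.+ 7) (trans p≡ (excess m)))
      p∣12w-1 : p ∣ ℤ.∣ + 12 ℤ.* + suc m ℤ.- 1ℤ ∣
      p∣12w-1 = p∣12w-r {m} {1} (trans (shifted m) (cong (ℕ._+ 1) (sym p≡)))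
        where
        shifted : ∀ m → 12 ℕ.* suc m ≡ 12 ℕ.* m ℕ.+ 11 ℕ.+ 1
        shifted = ℕ-Solver.solve-∀
      A₂≈XA₆ : coeff A[ suc (suc m) ,2] ≈ₚ mulX- 0ℚ (coeff A[ suc m ,6])
      A₂≈XA₆ = ≈ₚ-by (A₂-via-XA₆ m) (κ₂₆-vanishes ℕ.≤-refl (inj₁ p∣12w-1)) (A₂-integral (suc m) (ℕ.n≤1+n _))
      A₂≈YA₈ : coeff A[ suc (suc m) ,2] ≈ₚ mulX- (c 1728) (coeff A[ suc m ,8])
      A₂≈YA₈ = ≈ₚ-by (A₂-via-X₁₇₂₈A₈ m) (κ₂₈-vanishes ℕ.≤-refl (inj₁ p∣12w-1)) (A₂-integral (suc m) (ℕ.n≤1+n _))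
      A₆≈YA₀ : coeff A[ suc m ,6] ≈ₚ mulX- (c 1728) (coeff A[ suc m ,0])
      A₆≈YA₀ = ≈ₚ-by (A₆-via-X₁₇₂₈A₀ m) (κ₆₀-vanishes ℕ.≤-refl (inj₂ p∣12w-1)) (A₆-integral m (≤2+ m))


open import Data.Nat using (ℕ; _+_; _*_; _≤_)

reindex : ∀ {p} δ ε {a b c′ d a′ b′ c″ d′} → a ≡ a′ → b ≡ b′ → c′ ≡ c″ → d ≡ d′ →
  IntegralAndCongruent p A[ a′ ,2] ((X ^ₚ δ) ⊛ A[ b′ ,6]) ((X- (c 1728) ^ₚ ε) ⊛ A[ c″ ,8]) ((X ^ₚ δ) ⊛ (X- (c 1728) ^ₚ ε) ⊛ A[ d′ ,0]) →
  IntegralAndCongruent p A[ a ,2] ((X ^ₚ δ) ⊛ A[ b ,6]) ((X- (c 1728) ^ₚ ε) ⊛ A[ c′ ,8]) ((X ^ₚ δ) ⊛ (X- (c 1728) ^ₚ ε) ⊛ A[ d ,0])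
reindex δ ε refl refl refl refl h = h

+0 : ∀ n → n + 0 ≡ n
+0 = ℕ.+-identityʳ

+1 : ∀ n → n + 1 ≡ suc n
+1 n = ℕ.+-comm n 1

theorem2p6 : (p m δ ε : ℕ) → Prime p → 5 ≤ p → δ ≤ 1 → ε ≤ 1 →
    p ≡ 1 + (12 * m + 4 * δ + 6 * ε) →
    let P₁ = A[ m + δ + ε ,2]
        P₂ = (X ^ₚ δ) ⊛ A[ m + ε ,6]
        P₃ = (X- (c 1728) ^ₚ ε) ⊛ A[ m + δ ,8]
        P₄ = (X ^ₚ δ) ⊛ (X- (c 1728) ^ₚ ε) ⊛ A[ m + 1 ,0]
    in (PIntegralPoly p P₁ × PIntegralPoly p P₂ × PIntegralPoly p P₃ × PIntegralPoly p P₄)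
     × (P₁ ≡ P₂ [modₚ p ]) × (P₁ ≡ P₃ [modₚ p ]) × (P₁ ≡ P₄ [modₚ p ])
     × (P₂ ≡ P₃ [modₚ p ]) × (P₂ ≡ P₄ [modₚ p ]) × (P₃ ≡ P₄ [modₚ p ])
theorem2p6 p zero    _ _ _       5≤p z≤n       z≤n       refl = ⊥-elim (5≰1 5≤p)
  where
  5≰1 : ¬ 5 ≤ 1
  5≰1 (s≤s ())
theorem2p6 p (suc n) _ _ p-prime _   z≤n       z≤n       p≡ =
  reindex 0 0 (trans (+0 (suc n + 0)) (+0 (suc n))) (+0 (suc n)) (+0 (suc n)) (+1 (suc n)) (caseA n (trans p≡ (residue n)))
  where
  open Modulo p p-prime
  residue : ∀ n → 1 + (12 * suc n + 4 * 0 + 6 * 0) ≡ 12 * suc n + 1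
  residue = ℕ-Solver.solve-∀
theorem2p6 p m       _ _ p-prime _   (s≤s z≤n) z≤n       p≡ =
  reindex 1 0 (trans (+0 (m + 1)) (+1 m)) (+0 m) (+1 m) (+1 m) (caseB m (trans p≡ (residue m)))
  where
  open Modulo p p-prime
  residue : ∀ m → 1 + (12 * m + 4 * 1 + 6 * 0) ≡ 12 * m + 5
  residue = ℕ-Solver.solve-∀
theorem2p6 p m       _ _ p-prime _   z≤n       (s≤s z≤n) p≡ =
  reindex 0 1 (trans (cong (_+ 1) (+0 m)) (+1 m)) (+1 m) (+0 m) (+1 m) (caseC m (trans p≡ (residue m)))
  where
  open Modulo p p-prime
  residue : ∀ m → 1 + (12 * m + 4 * 0 + 6 * 1) ≡ 12 * m + 7
  residue = ℕ-Solver.solve-∀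
theorem2p6 p m       _ _ p-prime _   (s≤s z≤n) (s≤s z≤n) p≡ =
  reindex 1 1 (trans (cong (_+ 1) (+1 m)) (+1 (suc m))) (+1 m) (+1 m) (+1 m) (caseD m (trans p≡ (residue m)))
  where
  open Modulo p p-prime
  residue : ∀ m → 1 + (12 * m + 4 * 1 + 6 * 1) ≡ 12 * m + 11
  residue = ℕ-Solver.solve-∀
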